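{- There is an absolute constant $c>0$ such that, in the setting of the context, if $\epsilon\Delta\ge3$, $v$ is a sparse vertex and $|N(v)|\ge(1-\epsilon/4)\Delta$, then $\mathbf{E}[|J|]\ge c\,\epsilon^2\Delta$, where $J$ is the set of colors that are good for $v$.
   Context: Let $G=(V,E)$ be a finite simple graph with maximum degree $\Delta$ and neighborhoods $N(v)$. Each vertex $v$ has a palette $\operatorname{Pal}(v)$ of exactly $\Delta+1$ colors; $0$ is a blank color. Fix $\epsilon\in(0,1/5)$. An edge $uv$ is a friend edge if $|N(u)\cap N(v)|\ge(1-\epsilon)\Delta$; a vertex is sparse if it has fewer than $(1-\epsilon)\Delta$ friends. Initial coloring step: independently, each vertex sets $A(v)=0$ with probability $99/100$ and otherwise chooses $A(v)$ uniformly from $\operatorname{Pal}(v)$; then $\chi(v)=A(v)$ if $A(v)\ne0$ and no neighbor $w$ has $A(w)=A(v)$, else $\chi(v)=0$. A color $c\ne0$ is good for $v$ if $|\{w\in N(v):\chi(w)=c\}|\ge1+[c\in\operatorname{Pal}(v)]$, where $[P]$ is $1$ if $P$ holds and $0$ otherwise.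
   Formalization: The parameter ε ranges only over the rationals in (0,1/5). -}

module Defs where

open import Data.Bool using (Bool; true; false; _∧_; not; if_then_else_)
open import Data.Bool.ListAction using (any; all)
open import Data.Nat as ℕ using (ℕ; zero; suc; _≡ᵇ_; _≤ᵇ_)
open import Data.Fin using (Fin)
open import Data.Fin.Base using () renaming (suc to fsuc)
open import Data.List using (List; []; _∷_; [_]; map; concatMap; filterᵇ; filter; length; foldr; deduplicate; allFin)
open import Data.Vec.Functional using (Vector) renaming (_∷_ to _∷ᵛ_)
open import Data.Integer using (+_)
open import Data.Rational using (ℚ; _+_; _*_; _-_; _/_; 0ℚ; 1ℚ; _≤_; _<_)
open import Data.Rational.Properties using (_≤?_)
open import Relation.Binary.PropositionalEquality using (_≡_)

record Graph (n : ℕ) : Set where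
  field
    adj   : Fin n → Fin n → Bool
    symm  : ∀ u v → adj u v ≡ adj v u
    irrefl : ∀ v → adj v v ≡ false
open Graph public

module _ {n : ℕ} (G : Graph n) where

  nbrs : Fin n → List (Fin n)
  nbrs v = filterᵇ (adj G v) (allFin n)

  deg : Fin n → ℕ
  deg v = length (nbrs v)

  common : Fin n → Fin n → ℕ
  common u v = length (filterᵇ (λ w → adj G u w ∧ adj G v w) (allFin n))

  IsMaxDegree : ℕ → Set
  IsMaxDegree Δ = (∀ v → deg v ℕ.≤ Δ) × Σ (Fin n) (λ v → deg v ≡ Δ)
    where open import Data.Product using (_×_; Σ)

toℚ : ℕ → ℚ
toℚ k = + k / 1

module _ {n : ℕ} (G : Graph n) (Δ : ℕ) (ε : ℚ) where

  friendThreshold : ℚ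
  friendThreshold = (1ℚ - ε) * toℚ Δ

  friendCount : Fin n → ℕ
  friendCount v = length (filter (λ u → friendThreshold ≤? toℚ (common G u v)) (nbrs G v))

  Sparse : Fin n → Set
  Sparse v = toℚ (friendCount v) < friendThreshold

-- Colors are natural numbers; 0 is the blank color.
module _ {n : ℕ} (G : Graph n) (Pal : Fin n → List ℕ) where

  χ : (Fin n → ℕ) → Fin n → ℕ
  χ A v = if not (A v ≡ᵇ 0) ∧ all (λ w → not (A w ≡ᵇ A v)) (nbrs G v)
          then A v else 0

  inPal : ℕ → Fin n → Bool
  inPal c v = any (c ≡ᵇ_) (Pal v)

  colorCount : (Fin n → ℕ) → Fin n → ℕ → ℕ
  colorCount A v c = length (filterᵇ (λ w → χ A w ≡ᵇ c) (nbrs G v))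

  iverson : Bool → ℕ
  iverson true = 1
  iverson false = 0

  isGood : (Fin n → ℕ) → Fin n → ℕ → Bool
  isGood A v c = not (c ≡ᵇ 0) ∧ (suc (iverson (inPal c v)) ≤ᵇ colorCount A v c)

  -- All colors occurring in some palette (any good color is χ(w) for some w, hence lies here)
  allColors : List ℕ
  allColors = deduplicate ℕ._≟_ (concatMap Pal (allFin n))

  Jsize : (Fin n → ℕ) → Fin n → ℕ
  Jsize A v = length (filterᵇ (isGood A v) allColors)

assignments : (n : ℕ) → (Fin n → List ℕ) → List (Vector ℕ n)
assignments zero    opts = [ (λ ()) ]
assignments (suc n) opts =
  concatMap (λ a → map (a ∷ᵛ_) (assignments n (λ i → opts (fsuc i)))) (opts Fin.zero)
  where import Data.Fin as Fin

sumℚ : List ℚ → ℚ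
sumℚ = foldr _+_ 0ℚ

prodℚ : List ℚ → ℚ
prodℚ = foldr _*_ 1ℚ

-- Probability that A(v) = a in the initial coloring step (a ∈ {0} ∪ Pal(v)):
-- 99/100 for the blank color, (1/100)·1/(Δ+1) for each palette color.
choiceProb : ℕ → ℕ → ℚ
choiceProb Δ zero    = + 99 / 100
choiceProb Δ (suc _) = (+ 1 / 100) * (+ 1 / suc Δ)

expect : {n : ℕ} → (Pal : Fin n → List ℕ) → (Δ : ℕ) → ((Fin n → ℕ) → ℚ) → ℚ
expect {n} Pal Δ X =
  sumℚ (map (λ A → prodℚ (map (λ v → choiceProb Δ (A v)) (allFin n)) * X A)
            (assignments n (λ v → 0 ∷ Pal v)))

expectedJ : {n : ℕ} → Graph n → (Pal : Fin n → List ℕ) → ℕ → Fin n → ℚ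
expectedJ G Pal Δ v = expect Pal Δ (λ A → toℚ (Jsize G Pal A v))

module Submission where

open import Defs
open import Data.Nat using (ℕ; zero; suc)
import Data.Nat as ℕ
open import Data.Fin using (Fin)
open import Data.List using (List; length)
open import Data.List.Relation.Unary.All using (All)
open import Data.List.Relation.Unary.Unique.Propositional using (Unique)
open import Data.Product using (Σ; _×_; _,_)
open import Data.Integer using (+_)
open import Data.Rational using (ℚ; 0ℚ; 1ℚ; _*_; _-_; _/_; _≤_; _<_)
open import Relation.Binary.PropositionalEquality using (_≡_; _≢_)

-- A colour c is witnessed at a neighbour x of v if c ∉ Pal(v), A(x) = c and no other vertex
-- of N(v) ∪ N(x) chooses c; it is witnessed at a non-adjacent pair u, w of neighbours of v if
-- c ∈ Pal(v), A(u) = A(w) = c and no other vertex of N(v) ∪ N(u) ∪ N(w) chooses c.  Either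
-- event makes c good for v, and a good colour has at most 1 + 4 witnesses, so |J| is at least
-- a fifth of the number of witnesses.  With q = 1/(100(Δ+1)), a witness at x has probability
-- ≥ 0.97 q [c ∈ Pal(x)] and one at (u, w) has probability ≥ 0.97 q² [c ∈ Pal(u) ∩ Pal(w)],
-- the factor 0.97 being a union bound over the at most 3Δ vertices that must avoid c.  For a
-- non-adjacent pair, |Pal(u) ∩ Pal(w) ∩ Pal(v)| + |Pal(u) ∖ Pal(v)| + |Pal(w) ∖ Pal(v)| ≥ Δ + 1,
-- so the expected number of witnesses is at least (0.97/100) q times the number of non-edges
-- in N(v).  Finally v has at least (3/4) εΔ non-friend neighbours, each non-adjacent to at
-- least (5/12) εΔ neighbours of v, giving (5/16) (εΔ)² non-edges and E|J| ≥ 10⁻⁶ ε² Δ.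

module RationalArithmetic where
  import Data.Nat.Properties as ℕ
  open import Data.Integer as ℤ using ()
  import Data.Integer.Properties as ℤ
  open import Data.Rational as ℚ using (_+_; mkℚ)
  open import Data.Rational.Properties
  import Data.Nat.Coprimality as Coprime
  open import Data.Rational.Solver using (module +-*-Solver)
  open +-*-Solver
  open import Relation.Binary.PropositionalEquality

  toℚ≡mkℚ : ∀ k → toℚ k ≡ mkℚ (+ k) 0 (Coprime.sym (Coprime.1-coprimeTo k))
  toℚ≡mkℚ k = normalize-coprime _

  toℚ-+ : ∀ a b → toℚ (a ℕ.+ b) ≡ toℚ a + toℚ b
  toℚ-+ a b = trans (cong (_/ 1) lhs≡) (cong₂ _+_ (sym (toℚ≡mkℚ a)) (sym (toℚ≡mkℚ b)))
    where
    lhs≡ : + (a ℕ.+ b) ≡ + a ℤ.* + 1 ℤ.+ + b ℤ.* + 1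
    lhs≡ = sym (trans (cong₂ ℤ._+_ (ℤ.*-identityʳ (+ a)) (ℤ.*-identityʳ (+ b))) (ℤ.pos-+ a b))

  toℚ-* : ∀ a b → toℚ (a ℕ.* b) ≡ toℚ a * toℚ b
  toℚ-* a b = trans (cong (_/ 1) (ℤ.pos-* a b)) (cong₂ _*_ (sym (toℚ≡mkℚ a)) (sym (toℚ≡mkℚ b)))

  toℚ-mono-≤ : ∀ {a b} → a ℕ.≤ b → toℚ a ≤ toℚ b
  toℚ-mono-≤ {a} {b} a≤b rewrite toℚ≡mkℚ a | toℚ≡mkℚ b =
    ℚ.*≤* (subst₂ ℤ._≤_ (sym (ℤ.*-identityʳ (+ a))) (sym (ℤ.*-identityʳ (+ b))) (ℤ.+≤+ a≤b))

  0≤toℚ : ∀ a → 0ℚ ≤ toℚ a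
  0≤toℚ a = toℚ-mono-≤ {0} {a} ℕ.z≤n

  *-monoˡ-≤-0≤ : ∀ {a b c} → 0ℚ ≤ a → b ≤ c → a * b ≤ a * c
  *-monoˡ-≤-0≤ {a} 0≤a = *-monoˡ-≤-nonNeg a {{ℚ.nonNegative 0≤a}}

  *-monoʳ-≤-0≤ : ∀ {a b c} → 0ℚ ≤ a → b ≤ c → b * a ≤ c * a
  *-monoʳ-≤-0≤ {a} 0≤a = *-monoʳ-≤-nonNeg a {{ℚ.nonNegative 0≤a}}

  0≤* : ∀ {a b} → 0ℚ ≤ a → 0ℚ ≤ b → 0ℚ ≤ a * b
  0≤* {a} 0≤a 0≤b = ≤-trans (≤-reflexive (sym (*-zeroʳ a))) (*-monoˡ-≤-0≤ 0≤a 0≤b)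

  p≤q⇒0≤q-p : ∀ {p q} → p ≤ q → 0ℚ ≤ q - p
  p≤q⇒0≤q-p {p} p≤q = ≤-trans (≤-reflexive (sym (+-inverseʳ p))) (+-monoˡ-≤ (ℚ.- p) p≤q)

  0≤q-p⇒p≤q : ∀ {p q} → 0ℚ ≤ q - p → p ≤ q
  0≤q-p⇒p≤q {p} {q} 0≤q-p = ≤-trans (≤-reflexive (sym (+-identityʳ p)))
    (≤-trans (+-monoʳ-≤ p 0≤q-p) (≤-reflexive (solve 2 (λ p q → p :+ (q :- p) := q) refl p q)))

  p≤p+q : ∀ {p q} → 0ℚ ≤ q → p ≤ p + q
  p≤p+q {p} 0≤q = ≤-trans (≤-reflexive (sym (+-identityʳ p))) (+-monoʳ-≤ p 0≤q)

  1-antimono : ∀ {p q} → p ≤ q → 1ℚ - q ≤ 1ℚ - p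
  1-antimono p≤q = +-monoʳ-≤ 1ℚ (neg-antimono-≤ p≤q)

module Sums where
  import Data.Nat.Properties as ℕ
  open import Data.Nat.ListAction using (sum)
  open import Data.Nat.ListAction.Properties using (sum-++)
  open import Data.Rational using (_+_)
  open import Data.Rational.Properties
  open import Data.Rational.Solver using (module +-*-Solver)
  open +-*-Solver
  open import Data.Fin using () renaming (zero to fzero; suc to fsuc)
  open import Data.List using ([]; _∷_; _++_; map; concatMap; allFin)
  import Data.List.Properties as List
  open import Function using (_∘_; id)
  open import Relation.Binary.PropositionalEquality
  open RationalArithmetic
  open import Algebra.Bundles using (CommutativeMonoid)
  open import Algebra.Properties.CommutativeSemigroup using (interchange)

  private
    ℕ-+-interchange = interchange ℕ.+-commutativeSemigroup
    ℚ-+-interchange = interchange (CommutativeMonoid.commutativeSemigroup +-0-commutativeMonoid)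
    ℚ-*-interchange = interchange (CommutativeMonoid.commutativeSemigroup *-1-commutativeMonoid)

  Σℕ : {A : Set} → List A → (A → ℕ) → ℕ
  Σℕ L f = sum (map f L)

  Σℚ : {A : Set} → List A → (A → ℚ) → ℚ
  Σℚ L f = sumℚ (map f L)

  Πℚ : {A : Set} → List A → (A → ℚ) → ℚ
  Πℚ L f = prodℚ (map f L)

  module _ {A : Set} where
    Σℕ-cong : (L : List A) {f g : A → ℕ} → (∀ x → f x ≡ g x) → Σℕ L f ≡ Σℕ L g
    Σℕ-cong []      f≡g = refl
    Σℕ-cong (x ∷ L) f≡g = cong₂ ℕ._+_ (f≡g x) (Σℕ-cong L f≡g)

    Σℕ-mono : (L : List A) {f g : A → ℕ} → (∀ x → f x ℕ.≤ g x) → Σℕ L f ℕ.≤ Σℕ L g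
    Σℕ-mono []      f≤g = ℕ.z≤n
    Σℕ-mono (x ∷ L) f≤g = ℕ.+-mono-≤ (f≤g x) (Σℕ-mono L f≤g)

    Σℕ-zero : (L : List A) → Σℕ L (λ _ → 0) ≡ 0
    Σℕ-zero []      = refl
    Σℕ-zero (_ ∷ L) = Σℕ-zero L

    Σℕ-one : (L : List A) → Σℕ L (λ _ → 1) ≡ length L
    Σℕ-one []      = refl
    Σℕ-one (_ ∷ L) = cong suc (Σℕ-one L)

    Σℕ-+ : (L : List A) (f g : A → ℕ) → Σℕ L (λ x → f x ℕ.+ g x) ≡ Σℕ L f ℕ.+ Σℕ L g
    Σℕ-+ []      f g = refl
    Σℕ-+ (x ∷ L) f g rewrite Σℕ-+ L f g = ℕ-+-interchange (f x) (g x) (Σℕ L f) (Σℕ L g)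

    Σℕ-scaleˡ : (L : List A) (k : ℕ) (f : A → ℕ) → Σℕ L (λ x → k ℕ.* f x) ≡ k ℕ.* Σℕ L f
    Σℕ-scaleˡ []      k f = sym (ℕ.*-zeroʳ k)
    Σℕ-scaleˡ (x ∷ L) k f rewrite Σℕ-scaleˡ L k f = sym (ℕ.*-distribˡ-+ k (f x) (Σℕ L f))

    Σℕ-++ : (M N : List A) (f : A → ℕ) → Σℕ (M ++ N) f ≡ Σℕ M f ℕ.+ Σℕ N f
    Σℕ-++ M N f = trans (cong sum (List.map-++ f M N)) (sum-++ (map f M) (map f N))

    Σℚ-cong : (L : List A) {f g : A → ℚ} → (∀ x → f x ≡ g x) → Σℚ L f ≡ Σℚ L g
    Σℚ-cong []      f≡g = refl
    Σℚ-cong (x ∷ L) f≡g = cong₂ _+_ (f≡g x) (Σℚ-cong L f≡g)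

    Σℚ-mono : (L : List A) {f g : A → ℚ} → (∀ x → f x ≤ g x) → Σℚ L f ≤ Σℚ L g
    Σℚ-mono []      f≤g = ≤-refl
    Σℚ-mono (x ∷ L) f≤g = +-mono-≤ (f≤g x) (Σℚ-mono L f≤g)

    0≤Σℚ : (L : List A) {f : A → ℚ} → (∀ x → 0ℚ ≤ f x) → 0ℚ ≤ Σℚ L f
    0≤Σℚ []      0≤f = ≤-refl
    0≤Σℚ (x ∷ L) 0≤f = +-mono-≤ (0≤f x) (0≤Σℚ L 0≤f)

    Σℚ-zero : (L : List A) → Σℚ L (λ _ → 0ℚ) ≡ 0ℚ
    Σℚ-zero []      = refl
    Σℚ-zero (_ ∷ L) rewrite Σℚ-zero L = refl

    Σℚ-+ : (L : List A) (f g : A → ℚ) → Σℚ L (λ x → f x + g x) ≡ Σℚ L f + Σℚ L g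
    Σℚ-+ []      f g = refl
    Σℚ-+ (x ∷ L) f g rewrite Σℚ-+ L f g = ℚ-+-interchange (f x) (g x) (Σℚ L f) (Σℚ L g)

    Σℚ-scaleˡ : (L : List A) (k : ℚ) (f : A → ℚ) → Σℚ L (λ x → k * f x) ≡ k * Σℚ L f
    Σℚ-scaleˡ []      k f = sym (*-zeroʳ k)
    Σℚ-scaleˡ (x ∷ L) k f rewrite Σℚ-scaleˡ L k f = sym (*-distribˡ-+ k (f x) (Σℚ L f))

    Σℚ-scaleʳ : (L : List A) (k : ℚ) (f : A → ℚ) → Σℚ L (λ x → f x * k) ≡ Σℚ L f * k
    Σℚ-scaleʳ L k f = trans (Σℚ-cong L (λ x → *-comm (f x) k)) (trans (Σℚ-scaleˡ L k f) (*-comm k _))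

    Σℚ-++ : (M N : List A) (f : A → ℚ) → Σℚ (M ++ N) f ≡ Σℚ M f + Σℚ N f
    Σℚ-++ []      N f = sym (+-identityˡ _)
    Σℚ-++ (y ∷ M) N f rewrite Σℚ-++ M N f = sym (+-assoc (f y) (Σℚ M f) (Σℚ N f))

    toℚ-Σℕ : (L : List A) (f : A → ℕ) → toℚ (Σℕ L f) ≡ Σℚ L (toℚ ∘ f)
    toℚ-Σℕ []      f = refl
    toℚ-Σℕ (x ∷ L) f = trans (toℚ-+ (f x) (Σℕ L f)) (cong (_+_ (toℚ (f x))) (toℚ-Σℕ L f))

    Σℚ-*toℚ : (L : List A) (k : ℚ) (f : A → ℕ) → Σℚ L (λ x → k * toℚ (f x)) ≡ k * toℚ (Σℕ L f)
    Σℚ-*toℚ L k f = trans (Σℚ-scaleˡ L k _) (cong (k *_) (sym (toℚ-Σℕ L f)))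

    Πℚ-cong : (L : List A) {f g : A → ℚ} → (∀ x → f x ≡ g x) → Πℚ L f ≡ Πℚ L g
    Πℚ-cong []      f≡g = refl
    Πℚ-cong (x ∷ L) f≡g = cong₂ _*_ (f≡g x) (Πℚ-cong L f≡g)

    0≤Πℚ : (L : List A) {f : A → ℚ} → (∀ x → 0ℚ ≤ f x) → 0ℚ ≤ Πℚ L f
    0≤Πℚ []      0≤f = ≤ᵇ⇒≤ _
    0≤Πℚ (x ∷ L) 0≤f = 0≤* (0≤f x) (0≤Πℚ L 0≤f)

    Πℚ-* : (L : List A) (f g : A → ℚ) → Πℚ L (λ x → f x * g x) ≡ Πℚ L f * Πℚ L g
    Πℚ-* []      f g = refl
    Πℚ-* (x ∷ L) f g rewrite Πℚ-* L f g = ℚ-*-interchange (f x) (g x) (Πℚ L f) (Πℚ L g)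

    Πℚ-one : (L : List A) → Πℚ L (λ _ → 1ℚ) ≡ 1ℚ
    Πℚ-one []      = refl
    Πℚ-one (_ ∷ L) rewrite Πℚ-one L = refl

    Πℚ-≥-1-Σℚ : (L : List A) (g α β : A → ℚ) →
      (∀ x → 0ℚ ≤ g x) → (∀ x → 0ℚ ≤ α x) → (∀ x → 0ℚ ≤ β x) → (∀ x → β x ≤ 1ℚ) →
      (∀ x → α x * (1ℚ - β x) ≤ g x) → Πℚ L α * (1ℚ - Σℚ L β) ≤ Πℚ L g
    Πℚ-≥-1-Σℚ []      g α β 0≤g 0≤α 0≤β β≤1 αβ≤g = ≤-refl
    Πℚ-≥-1-Σℚ (x ∷ L) g α β 0≤g 0≤α 0≤β β≤1 αβ≤g = begin
      (α x * P) * (1ℚ - (β x + B))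
        ≤⟨ *-monoˡ-≤-0≤ (0≤* (0≤α x) 0≤P) (p≤p+q {1ℚ - (β x + B)} (0≤* (0≤β x) 0≤B)) ⟩
      (α x * P) * ((1ℚ - (β x + B)) + β x * B)
        ≡⟨ solve 4 (λ a p b c → (a :* p) :* ((con 1ℚ :- (b :+ c)) :+ b :* c)
                                := (a :* (con 1ℚ :- b)) :* (p :* (con 1ℚ :- c))) refl (α x) P (β x) B ⟩
      (α x * (1ℚ - β x)) * (P * (1ℚ - B))
        ≤⟨ *-monoˡ-≤-0≤ (0≤* (0≤α x) (p≤q⇒0≤q-p (β≤1 x))) (Πℚ-≥-1-Σℚ L g α β 0≤g 0≤α 0≤β β≤1 αβ≤g) ⟩
      (α x * (1ℚ - β x)) * Πℚ L g
        ≤⟨ *-monoʳ-≤-0≤ (0≤Πℚ L 0≤g) (αβ≤g x) ⟩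
      g x * Πℚ L g ∎
      where
      open ≤-Reasoning
      P = Πℚ L α
      B = Σℚ L β
      0≤P = 0≤Πℚ L 0≤α
      0≤B = 0≤Σℚ L 0≤β

  module _ {A B : Set} where
    Σℕ-swap : (L : List A) (M : List B) (f : A → B → ℕ) →
      Σℕ L (λ x → Σℕ M (f x)) ≡ Σℕ M (λ y → Σℕ L (λ x → f x y))
    Σℕ-swap []      M f = sym (Σℕ-zero M)
    Σℕ-swap (x ∷ L) M f rewrite Σℕ-swap L M f = sym (Σℕ-+ M (f x) (λ y → Σℕ L (λ x → f x y)))

    Σℕ-concatMap : (L : List B) (g : B → List A) (f : A → ℕ) → Σℕ (concatMap g L) f ≡ Σℕ L (λ b → Σℕ (g b) f)
    Σℕ-concatMap []      g f = refl
    Σℕ-concatMap (b ∷ L) g f = trans (Σℕ-++ (g b) _ f) (cong (Σℕ (g b) f ℕ.+_) (Σℕ-concatMap L g f))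

    Σℕ-map : (L : List B) (g : B → A) (f : A → ℕ) → Σℕ (map g L) f ≡ Σℕ L (f ∘ g)
    Σℕ-map []      g f = refl
    Σℕ-map (b ∷ L) g f = cong (f (g b) ℕ.+_) (Σℕ-map L g f)

    Σℚ-concatMap : (L : List B) (g : B → List A) (f : A → ℚ) → Σℚ (concatMap g L) f ≡ Σℚ L (λ b → Σℚ (g b) f)
    Σℚ-concatMap []      g f = refl
    Σℚ-concatMap (b ∷ L) g f = trans (Σℚ-++ (g b) _ f) (cong (_+_ (Σℚ (g b) f)) (Σℚ-concatMap L g f))

    Σℚ-map : (L : List B) (g : B → A) (f : A → ℚ) → Σℚ (map g L) f ≡ Σℚ L (f ∘ g)
    Σℚ-map []      g f = refl
    Σℚ-map (b ∷ L) g f = cong (_+_ (f (g b))) (Σℚ-map L g f)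

  module _ {n : ℕ} where
    Σℕ-allFin-suc : (f : Fin (suc n) → ℕ) → Σℕ (allFin (suc n)) f ≡ f fzero ℕ.+ Σℕ (allFin n) (f ∘ fsuc)
    Σℕ-allFin-suc f = cong (λ l → f fzero ℕ.+ sum l)
      (trans (List.map-tabulate fsuc f) (sym (List.map-tabulate id (f ∘ fsuc))))

    Πℚ-allFin-suc : (f : Fin (suc n) → ℚ) → Πℚ (allFin (suc n)) f ≡ f fzero * Πℚ (allFin n) (f ∘ fsuc)
    Πℚ-allFin-suc f = cong (λ l → f fzero * prodℚ l)
      (trans (List.map-tabulate fsuc f) (sym (List.map-tabulate id (f ∘ fsuc))))

module Counting where
  open import Data.Bool using (Bool; true; false; not; _∧_; _∨_; if_then_else_; T)
  open import Data.Bool.ListAction using (any; all)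
  open import Data.Nat using (_≡ᵇ_)
  import Data.Nat.Properties as ℕ
  open import Data.Fin using () renaming (zero to fzero; suc to fsuc)
  open import Data.List using ([]; _∷_; allFin; tabulate; filter; filterᵇ)
  open import Data.List.Relation.Unary.All using ([]; _∷_)
  open import Data.List.Relation.Unary.Any using (here; there)
  open import Data.List.Relation.Unary.AllPairs using ([]; _∷_)
  open import Data.List.Membership.Propositional using (_∈_)
  open import Data.Product using (_,_; proj₁; proj₂)
  open import Data.Sum using (_⊎_; inj₁; inj₂)
  open import Data.Empty using (⊥; ⊥-elim)
  open import Function using (_∘_; id)
  open import Relation.Nullary using (does)
  open import Relation.Unary using (Pred; Decidable)
  open import Relation.Binary.PropositionalEquality
  open Sums
  open import Data.Rational.Properties using (*-identityˡ; *-identityʳ)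

  𝟙 : Bool → ℕ
  𝟙 true  = 1
  𝟙 false = 0

  𝟙≤1 : ∀ b → 𝟙 b ℕ.≤ 1
  𝟙≤1 true  = ℕ.s≤s ℕ.z≤n
  𝟙≤1 false = ℕ.z≤n

  𝟙≡1⇒true : ∀ {b} → 𝟙 b ≡ 1 → b ≡ true
  𝟙≡1⇒true {true} _ = refl

  𝟙-not : ∀ b → 𝟙 (not b) ℕ.+ 𝟙 b ≡ 1
  𝟙-not true  = refl
  𝟙-not false = refl

  𝟙-∨ : ∀ a b → 𝟙 (a ∨ b) ℕ.≤ 𝟙 a ℕ.+ 𝟙 b
  𝟙-∨ true  b = ℕ.s≤s ℕ.z≤n
  𝟙-∨ false b = ℕ.≤-refl

  ∧-split : ∀ {a b} → (a ∧ b) ≡ true → (a ≡ true) × (b ≡ true)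
  ∧-split {true} {true} _ = refl , refl

  not-true : ∀ {b} → not b ≡ true → b ≡ false
  not-true {false} _ = refl

  ∨-zeroʳ : ∀ a → (a ∨ true) ≡ true
  ∨-zeroʳ true  = refl
  ∨-zeroʳ false = refl

  ∨-trueˡ : ∀ {a} b → a ≡ true → (a ∨ b) ≡ true
  ∨-trueˡ b refl = refl

  true≢false : ∀ {a} → a ≡ true → a ≡ false → ⊥
  true≢false refl ()

  ≡ᵇ⇒≡ : ∀ {x y} → (x ≡ᵇ y) ≡ true → x ≡ y
  ≡ᵇ⇒≡ {x} {y} e = ℕ.≡ᵇ⇒≡ x y (subst T (sym e) _)

  ≡ᵇ-refl : ∀ a → (a ≡ᵇ a) ≡ true
  ≡ᵇ-refl zero    = refl
  ≡ᵇ-refl (suc a) = ≡ᵇ-refl a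

  ≡ᵇ-sym : ∀ a b → (a ≡ᵇ b) ≡ (b ≡ᵇ a)
  ≡ᵇ-sym zero    zero    = refl
  ≡ᵇ-sym zero    (suc b) = refl
  ≡ᵇ-sym (suc a) zero    = refl
  ≡ᵇ-sym (suc a) (suc b) = ≡ᵇ-sym a b

  ≢⇒≡ᵇ-false : ∀ {a b} → a ≢ b → (a ≡ᵇ b) ≡ false
  ≢⇒≡ᵇ-false {a} {b} a≢b with a ≡ᵇ b in eq
  ... | true  = ⊥-elim (a≢b (≡ᵇ⇒≡ eq))
  ... | false = refl

  ≡ᵇ-false⇒≢ : ∀ {a b} → (a ≡ᵇ b) ≡ false → a ≢ b
  ≡ᵇ-false⇒≢ {a} e refl = true≢false (≡ᵇ-refl a) e

  _=ᶠ_ : ∀ {n} → Fin n → Fin n → Bool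
  fzero  =ᶠ fzero  = true
  fzero  =ᶠ fsuc _ = false
  fsuc _ =ᶠ fzero  = false
  fsuc x =ᶠ fsuc y = x =ᶠ y

  =ᶠ-refl : ∀ {n} (x : Fin n) → (x =ᶠ x) ≡ true
  =ᶠ-refl fzero    = refl
  =ᶠ-refl (fsuc x) = =ᶠ-refl x

  =ᶠ⇒≡ : ∀ {n} {x y : Fin n} → (x =ᶠ y) ≡ true → x ≡ y
  =ᶠ⇒≡ {x = fzero}  {fzero}  _ = refl
  =ᶠ⇒≡ {x = fsuc x} {fsuc y} e = cong fsuc (=ᶠ⇒≡ e)

  ≢⇒=ᶠ-false : ∀ {n} {x y : Fin n} → x ≢ y → (x =ᶠ y) ≡ false
  ≢⇒=ᶠ-false {x = x} {y} x≢y with x =ᶠ y in eq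
  ... | true  = ⊥-elim (x≢y (=ᶠ⇒≡ eq))
  ... | false = refl

  =ᶠ-false⇒≢ : ∀ {n} {x y : Fin n} → (x =ᶠ y) ≡ false → x ≢ y
  =ᶠ-false⇒≢ {x = x} e refl = true≢false (=ᶠ-refl x) e

  count-=ᶠ : ∀ {n} (x : Fin n) → Σℕ (allFin n) (λ y → 𝟙 (y =ᶠ x)) ≡ 1
  count-=ᶠ {suc n} fzero    = trans (Σℕ-allFin-suc {n} (λ y → 𝟙 (y =ᶠ fzero))) (cong suc (Σℕ-zero (allFin n)))
  count-=ᶠ {suc n} (fsuc x) = trans (Σℕ-allFin-suc {n} (λ y → 𝟙 (y =ᶠ fsuc x))) (count-=ᶠ x)

  Πℚ-single : ∀ {n} (x : Fin n) (h : Fin n → ℚ) → Πℚ (allFin n) (λ y → if y =ᶠ x then h y else 1ℚ) ≡ h x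
  Πℚ-single {suc n} fzero h = trans (Πℚ-allFin-suc {n} (λ y → if y =ᶠ fzero then h y else 1ℚ))
    (trans (cong (h fzero *_) (Πℚ-one (allFin n))) (*-identityʳ (h fzero)))
  Πℚ-single {suc n} (fsuc x) h = trans (Πℚ-allFin-suc {n} (λ y → if y =ᶠ fsuc x then h y else 1ℚ))
    (trans (*-identityˡ _) (Πℚ-single x (h ∘ fsuc)))

  all-tabulate : ∀ {n} {A : Set} (f : A → Bool) (g : Fin n → A) → all f (tabulate g) ≡ true → ∀ y → f (g y) ≡ true
  all-tabulate f g e fzero    = proj₁ (∧-split e)
  all-tabulate f g e (fsuc y) = all-tabulate f (g ∘ fsuc) (proj₂ (∧-split {f (g fzero)} e)) y

  all-allFin : ∀ {n} (f : Fin n → Bool) → all f (allFin n) ≡ true → ∀ y → f y ≡ true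
  all-allFin f = all-tabulate f id

  module _ {A : Set} where
    length-filter≡Σ : ∀ {ℓ} {P : Pred A ℓ} (P? : Decidable P) (L : List A) →
      length (filter P? L) ≡ Σℕ L (λ y → 𝟙 (does (P? y)))
    length-filter≡Σ P? []      = refl
    length-filter≡Σ P? (x ∷ L) with does (P? x)
    ... | true  = cong suc (length-filter≡Σ P? L)
    ... | false = length-filter≡Σ P? L

    length-filterᵇ≡Σ : (p : A → Bool) (L : List A) → length (filterᵇ p L) ≡ Σℕ L (𝟙 ∘ p)
    length-filterᵇ≡Σ p []      = refl
    length-filterᵇ≡Σ p (x ∷ L) with p x
    ... | true  = cong suc (length-filterᵇ≡Σ p L)
    ... | false = length-filterᵇ≡Σ p L

    Σℕ-filterᵇ : (p : A → Bool) (L : List A) (h : A → ℕ) → Σℕ (filterᵇ p L) h ≡ Σℕ L (λ y → if p y then h y else 0)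
    Σℕ-filterᵇ p []      h = refl
    Σℕ-filterᵇ p (x ∷ L) h with p x
    ... | true  = cong (h x ℕ.+_) (Σℕ-filterᵇ p L h)
    ... | false = Σℕ-filterᵇ p L h

    all-filterᵇ : (p f : A → Bool) (L : List A) → (∀ y → p y ≡ true → f y ≡ true) → all f (filterᵇ p L) ≡ true
    all-filterᵇ p f []      p⇒f = refl
    all-filterᵇ p f (x ∷ L) p⇒f with p x in eq
    ... | true rewrite p⇒f x eq = all-filterᵇ p f L p⇒f
    ... | false = all-filterᵇ p f L p⇒f

    𝟙-any≤Σ : (f : A → Bool) (L : List A) → 𝟙 (any f L) ℕ.≤ Σℕ L (𝟙 ∘ f)
    𝟙-any≤Σ f []      = ℕ.z≤n
    𝟙-any≤Σ f (x ∷ L) with f x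
    ... | true  = ℕ.s≤s ℕ.z≤n
    ... | false = 𝟙-any≤Σ f L

    Σ≤1⇒Σ≤𝟙-any : (f : A → Bool) (L : List A) → Σℕ L (𝟙 ∘ f) ℕ.≤ 1 → Σℕ L (𝟙 ∘ f) ℕ.≤ 𝟙 (any f L)
    Σ≤1⇒Σ≤𝟙-any f []      _   = ℕ.z≤n
    Σ≤1⇒Σ≤𝟙-any f (x ∷ L) Σ≤1 with f x
    ... | true  = Σ≤1
    ... | false = Σ≤1⇒Σ≤𝟙-any f L Σ≤1

    Σ𝟙-not+Σ𝟙≡length : (f : A → Bool) (L : List A) → Σℕ L (λ a → 𝟙 (not (f a))) ℕ.+ Σℕ L (𝟙 ∘ f) ≡ length L
    Σ𝟙-not+Σ𝟙≡length f L = trans (sym (Σℕ-+ L _ _)) (trans (Σℕ-cong L (𝟙-not ∘ f)) (Σℕ-one L))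

    private
      Σ≡0⊎witness : (L : List A) (f : A → ℕ) → (∀ i → f i ℕ.≤ 1) → (Σ A λ i → f i ≡ 1) ⊎ (Σℕ L f ≡ 0)
      Σ≡0⊎witness []      f f≤1 = inj₂ refl
      Σ≡0⊎witness (x ∷ L) f f≤1 with f x in fx | f≤1 x | Σ≡0⊎witness L f f≤1
      ... | 1           | _          | _        = inj₁ (x , fx)
      ... | suc (suc _) | ℕ.s≤s ()   | _
      ... | 0           | _          | inj₁ w   = inj₁ w
      ... | 0           | _          | inj₂ Σ≡0 = inj₂ Σ≡0

    Σ𝟙≤m*𝟙 : (L : List A) (f : A → ℕ) (m : ℕ) (g : Bool) → (∀ i → f i ℕ.≤ 1) → (∀ i → f i ≡ 1 → g ≡ true) →
             (∀ i → f i ≡ 1 → Σℕ L f ℕ.≤ m) → Σℕ L f ℕ.≤ m ℕ.* 𝟙 g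
    Σ𝟙≤m*𝟙 L f m g f≤1 f⇒g Σ≤m with Σ≡0⊎witness L f f≤1
    ... | inj₁ (i , fi≡1) rewrite f⇒g i fi≡1 = subst (Σℕ L f ℕ.≤_) (sym (ℕ.*-identityʳ m)) (Σ≤m i fi≡1)
    ... | inj₂ Σ≡0 rewrite Σ≡0 = ℕ.z≤n

  occurrences : ℕ → List ℕ → ℕ
  occurrences c P = Σℕ P (λ a → 𝟙 (c ≡ᵇ a))

  occurrences-∉ : ∀ c P → All (c ≢_) P → occurrences c P ≡ 0
  occurrences-∉ c []      []           = refl
  occurrences-∉ c (x ∷ P) (c≢x ∷ c∉P) rewrite ≢⇒≡ᵇ-false c≢x = occurrences-∉ c P c∉P

  occurrences-unique : ∀ c P → Unique P → occurrences c P ℕ.≤ 1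
  occurrences-unique c []      []           = ℕ.z≤n
  occurrences-unique c (x ∷ P) (x∉P ∷ uP) with c ≡ᵇ x in eq
  ... | true  = ℕ.s≤s (ℕ.≤-reflexive (occurrences-∉ c P (subst (λ z → All (z ≢_) P) (sym (≡ᵇ⇒≡ eq)) x∉P)))
  ... | false = occurrences-unique c P uP

  occurrences-∈ : ∀ {c P} → c ∈ P → 1 ℕ.≤ Σℕ P (λ a → 𝟙 (a ≡ᵇ c))
  occurrences-∈ {c} (here refl) rewrite ≡ᵇ-refl c = ℕ.s≤s ℕ.z≤n
  occurrences-∈ {P = x ∷ P} (there c∈P) = ℕ.≤-trans (occurrences-∈ c∈P) (ℕ.m≤n+m _ (𝟙 (x ≡ᵇ _)))

module Expectation where
  open import Data.Rational using (_+_)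
  open import Data.Rational.Properties
  open import Data.Rational.Solver using (module +-*-Solver)
  open +-*-Solver
  open import Data.Fin using () renaming (zero to fzero; suc to fsuc)
  open import Data.List using ([]; _∷_; map; allFin)
  open import Data.Vec.Functional using () renaming (_∷_ to _∷ᵛ_)
  open import Function using (_∘_)
  open import Relation.Binary.PropositionalEquality
  open RationalArithmetic
  open Sums

  weight : {n : ℕ} → (ℕ → ℚ) → (Fin n → ℕ) → ℚ
  weight {n} p A = Πℚ (allFin n) (p ∘ A)

  module _ {n : ℕ} (p : ℕ → ℚ) (opts : Fin n → List ℕ) where

    𝔼 : ((Fin n → ℕ) → ℚ) → ℚ
    𝔼 X = Σℚ (assignments n opts) (λ A → weight p A * X A)

    𝔼-cong : ∀ {X Y} → (∀ A → X A ≡ Y A) → 𝔼 X ≡ 𝔼 Y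
    𝔼-cong X≡Y = Σℚ-cong (assignments n opts) (λ A → cong (weight p A *_) (X≡Y A))

    𝔼-+ : (X Y : (Fin n → ℕ) → ℚ) → 𝔼 (λ A → X A + Y A) ≡ 𝔼 X + 𝔼 Y
    𝔼-+ X Y = trans (Σℚ-cong (assignments n opts) (λ A → *-distribˡ-+ (weight p A) (X A) (Y A)))
                    (Σℚ-+ (assignments n opts) _ _)

    𝔼-scaleˡ : (k : ℚ) (X : (Fin n → ℕ) → ℚ) → 𝔼 (λ A → k * X A) ≡ k * 𝔼 X
    𝔼-scaleˡ k X = trans (Σℚ-cong (assignments n opts)
        (λ A → solve 3 (λ w k x → w :* (k :* x) := k :* (w :* x)) refl (weight p A) k (X A)))
      (Σℚ-scaleˡ (assignments n opts) k _)

    𝔼-zero : 𝔼 (λ _ → 0ℚ) ≡ 0ℚ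
    𝔼-zero = trans (Σℚ-cong (assignments n opts) (λ A → *-zeroʳ (weight p A))) (Σℚ-zero (assignments n opts))

    𝔼-Σℚ : {I : Set} (L : List I) (X : I → (Fin n → ℕ) → ℚ) → 𝔼 (λ A → Σℚ L (λ i → X i A)) ≡ Σℚ L (λ i → 𝔼 (X i))
    𝔼-Σℚ []      X = 𝔼-zero
    𝔼-Σℚ (i ∷ L) X = trans (𝔼-+ (X i) _) (cong (_+_ (𝔼 (X i))) (𝔼-Σℚ L X))

    module _ (0≤p : ∀ a → 0ℚ ≤ p a) where
      0≤weight : ∀ A → 0ℚ ≤ weight p A
      0≤weight A = 0≤Πℚ (allFin n) (0≤p ∘ A)

      𝔼-mono : {X Y : (Fin n → ℕ) → ℚ} → (∀ A → X A ≤ Y A) → 𝔼 X ≤ 𝔼 Y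
      𝔼-mono X≤Y = Σℚ-mono (assignments n opts) (λ A → *-monoˡ-≤-0≤ (0≤weight A) (X≤Y A))

      0≤𝔼 : {X : (Fin n → ℕ) → ℚ} → (∀ A → 0ℚ ≤ X A) → 0ℚ ≤ 𝔼 X
      0≤𝔼 0≤X = ≤-trans (≤-reflexive (sym 𝔼-zero)) (𝔼-mono 0≤X)

  𝔼-Πℚ : ∀ n (p : ℕ → ℚ) (opts : Fin n → List ℕ) (F : Fin n → ℕ → ℚ) →
    𝔼 p opts (λ A → Πℚ (allFin n) (λ y → F y (A y))) ≡ Πℚ (allFin n) (λ y → Σℚ (opts y) (λ a → p a * F y a))
  𝔼-Πℚ zero    p opts F = refl
  𝔼-Πℚ (suc m) p opts F = begin
    Σℚ (concatMap (λ a → map (a ∷ᵛ_) rest) (opts fzero)) Φ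
      ≡⟨ Σℚ-concatMap (opts fzero) (λ a → map (a ∷ᵛ_) rest) Φ ⟩
    Σℚ (opts fzero) (λ a → Σℚ (map (a ∷ᵛ_) rest) Φ)
      ≡⟨ Σℚ-cong (opts fzero) (λ a → trans (Σℚ-map rest (a ∷ᵛ_) Φ) (Σℚ-cong rest (Φ-∷ a))) ⟩
    Σℚ (opts fzero) (λ a → Σℚ rest (λ A → head a * (weight p A * Ψ A)))
      ≡⟨ Σℚ-cong (opts fzero) (λ a → Σℚ-scaleˡ rest (head a) _) ⟩
    Σℚ (opts fzero) (λ a → head a * 𝔼 p (opts ∘ fsuc) Ψ)
      ≡⟨ Σℚ-scaleʳ (opts fzero) _ head ⟩
    Σℚ (opts fzero) head * 𝔼 p (opts ∘ fsuc) Ψ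
      ≡⟨ cong (Σℚ (opts fzero) head *_) (𝔼-Πℚ m p (opts ∘ fsuc) (F ∘ fsuc)) ⟩
    Σℚ (opts fzero) head * Πℚ (allFin m) (λ y → Σℚ (opts (fsuc y)) (λ a → p a * F (fsuc y) a))
      ≡⟨ sym (Πℚ-allFin-suc (λ y → Σℚ (opts y) (λ a → p a * F y a))) ⟩
    Πℚ (allFin (suc m)) (λ y → Σℚ (opts y) (λ a → p a * F y a)) ∎
    where
    open ≡-Reasoning
    open import Data.List using (concatMap)
    rest = assignments m (opts ∘ fsuc)
    head : ℕ → ℚ
    head a = p a * F fzero a
    Φ : (Fin (suc m) → ℕ) → ℚ
    Φ A = weight p A * Πℚ (allFin (suc m)) (λ y → F y (A y))
    Ψ : (Fin m → ℕ) → ℚ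
    Ψ A = Πℚ (allFin m) (λ y → F (fsuc y) (A y))
    Φ-∷ : ∀ a A → Φ (a ∷ᵛ A) ≡ head a * (weight p A * Ψ A)
    Φ-∷ a A rewrite Πℚ-allFin-suc {m} (p ∘ (a ∷ᵛ A)) | Πℚ-allFin-suc {m} (λ y → F y ((a ∷ᵛ A) y)) =
      solve 4 (λ x y z w → (x :* y) :* (z :* w) := (x :* z) :* (y :* w)) refl (p a) (weight p A) (F fzero a) (Ψ A)

module ChoiceProbabilities where
  open import Data.Bool using (Bool; true; false; not; _∨_; if_then_else_)
  open import Data.Bool.ListAction using (any)
  open import Data.Nat using (_≡ᵇ_)
  import Data.Nat.Properties as ℕ
  open import Data.Rational as ℚ using (_+_; mkℚ)
  open import Data.Rational.Properties
  open import Data.Rational.Solver using (module +-*-Solver)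
  open +-*-Solver
  import Data.Nat.Coprimality as Coprime
  open import Data.List using ([]; _∷_)
  open import Data.List.Relation.Unary.All using ([]; _∷_)
  open import Data.Empty using (⊥-elim)
  open import Relation.Binary.PropositionalEquality
  open RationalArithmetic
  open Sums
  open Counting

  𝟙ℚ : Bool → ℚ
  𝟙ℚ b = toℚ (𝟙 b)

  0≤𝟙ℚ : ∀ b → 0ℚ ≤ 𝟙ℚ b
  0≤𝟙ℚ b = 0≤toℚ (𝟙 b)

  q : ℕ → ℚ
  q Δ = (+ 1 / 100) * (+ 1 / suc Δ)

  [1+Δ]*1/[1+Δ]≡1 : ∀ Δ → toℚ (suc Δ) * (+ 1 / suc Δ) ≡ 1ℚ
  [1+Δ]*1/[1+Δ]≡1 Δ rewrite normalize-coprime (Coprime.1-coprimeTo (suc Δ)) | toℚ≡mkℚ (suc Δ) =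
    *-inverseʳ (mkℚ (+ suc Δ) 0 (Coprime.sym (Coprime.1-coprimeTo (suc Δ))))

  q*[1+Δ]≡1/100 : ∀ Δ → q Δ * toℚ (suc Δ) ≡ + 1 / 100
  q*[1+Δ]≡1/100 Δ = begin
    (+ 1 / 100) * (+ 1 / suc Δ) * toℚ (suc Δ) ≡⟨ *-assoc (+ 1 / 100) (+ 1 / suc Δ) (toℚ (suc Δ)) ⟩
    (+ 1 / 100) * ((+ 1 / suc Δ) * toℚ (suc Δ)) ≡⟨ cong ((+ 1 / 100) *_) (trans (*-comm (+ 1 / suc Δ) (toℚ (suc Δ))) ([1+Δ]*1/[1+Δ]≡1 Δ)) ⟩
    (+ 1 / 100) * 1ℚ ≡⟨ *-identityʳ (+ 1 / 100) ⟩
    + 1 / 100 ∎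
    where open ≡-Reasoning

  0≤1/[1+Δ] : ∀ Δ → 0ℚ ≤ + 1 / suc Δ
  0≤1/[1+Δ] Δ rewrite normalize-coprime (Coprime.1-coprimeTo (suc Δ)) = ℚ.*≤* (Data.Integer.+≤+ ℕ.z≤n)
    where import Data.Integer

  0≤q : ∀ Δ → 0ℚ ≤ q Δ
  0≤q Δ = 0≤* {+ 1 / 100} (≤ᵇ⇒≤ _) (0≤1/[1+Δ] Δ)

  q*Δ≤1/100 : ∀ Δ → q Δ * toℚ Δ ≤ + 1 / 100
  q*Δ≤1/100 Δ = ≤-trans (*-monoˡ-≤-0≤ (0≤q Δ) (toℚ-mono-≤ (ℕ.n≤1+n Δ))) (≤-reflexive (q*[1+Δ]≡1/100 Δ))

  q≤1 : ∀ Δ → q Δ ≤ 1ℚ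
  q≤1 Δ = ≤-trans (p≤p+q {q Δ} (0≤* (0≤q Δ) (0≤toℚ Δ))) (≤-trans (≤-reflexive q+qΔ≡1/100) (≤ᵇ⇒≤ _))
    where
    q+qΔ≡1/100 : q Δ + q Δ * toℚ Δ ≡ + 1 / 100
    q+qΔ≡1/100 = trans (solve 2 (λ a d → a :+ a :* d := a :* (con 1ℚ :+ d)) refl (q Δ) (toℚ Δ))
                       (trans (cong (q Δ *_) (sym (toℚ-+ 1 Δ))) (q*[1+Δ]≡1/100 Δ))

  0≤choiceProb : ∀ Δ a → 0ℚ ≤ choiceProb Δ a
  0≤choiceProb Δ zero    = ≤ᵇ⇒≤ _
  0≤choiceProb Δ (suc a) = 0≤q Δ

  𝟙ℚ*≤ : ∀ b {k x} → (b ≡ true → k ≤ x) → 0ℚ ≤ x → 𝟙ℚ b * k ≤ x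
  𝟙ℚ*≤ true  {k} k≤x _   = ≤-trans (≤-reflexive (*-identityˡ k)) (k≤x refl)
  𝟙ℚ*≤ false {k} _   0≤x = ≤-trans (≤-reflexive (*-zeroˡ k)) 0≤x

  fitsᵇ : (isTarget mustAvoid : Bool) (c a : ℕ) → Bool
  fitsᵇ isTarget mustAvoid c a = if isTarget then c ≡ᵇ a else (if mustAvoid then not (c ≡ᵇ a) else true)

  pickFactor : Bool → ℚ → ℚ
  pickFactor isTarget p = if isTarget then p else 1ℚ

  0≤pickFactor : ∀ t {p} → 0ℚ ≤ p → 0ℚ ≤ pickFactor t p
  0≤pickFactor true  0≤p = 0≤p
  0≤pickFactor false _   = ≤ᵇ⇒≤ _

  pickFactor-∨ : ∀ s t p → (s ≡ true → t ≡ false) → pickFactor (s ∨ t) p ≡ pickFactor s p * pickFactor t p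
  pickFactor-∨ true  true  p s⇒¬t with () ← s⇒¬t refl
  pickFactor-∨ true  false p _     = sym (*-identityʳ p)
  pickFactor-∨ false t     p _     = sym (*-identityˡ (pickFactor t p))

  module _ (Δ : ℕ) where
    riskTerm : (isTarget mustAvoid : Bool) → ℚ
    riskTerm isTarget mustAvoid = if isTarget then 0ℚ else (if mustAvoid then q Δ else 0ℚ)

    0≤riskTerm : ∀ t a → 0ℚ ≤ riskTerm t a
    0≤riskTerm true  _     = ≤-refl
    0≤riskTerm false true  = 0≤q Δ
    0≤riskTerm false false = ≤-refl

    riskTerm≤1 : ∀ t a → riskTerm t a ≤ 1ℚ
    riskTerm≤1 true  _     = ≤ᵇ⇒≤ _
    riskTerm≤1 false true  = q≤1 Δ
    riskTerm≤1 false false = ≤ᵇ⇒≤ _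

    riskTerm≤q𝟙 : ∀ t a → riskTerm t a ≤ q Δ * 𝟙ℚ a
    riskTerm≤q𝟙 true  a     = 0≤* (0≤q Δ) (0≤𝟙ℚ a)
    riskTerm≤q𝟙 false true  = ≤-reflexive (sym (*-identityʳ (q Δ)))
    riskTerm≤q𝟙 false false = ≤-reflexive (sym (*-zeroʳ (q Δ)))

    Σ-choiceProb : (P : List ℕ) → All (_≢ 0) P → (F : ℕ → ℚ) → Σℚ P (λ a → choiceProb Δ a * F a) ≡ q Δ * Σℚ P F
    Σ-choiceProb []          []          F = sym (*-zeroʳ (q Δ))
    Σ-choiceProb (zero  ∷ P) (0≢0 ∷ _)   F = ⊥-elim (0≢0 refl)
    Σ-choiceProb (suc a ∷ P) (_ ∷ P≢0)   F rewrite Σ-choiceProb P P≢0 F = sym (*-distribˡ-+ (q Δ) (F (suc a)) _)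

    module Marginals (P : List ℕ) (P≢0 : All (_≢ 0) P) (uniqueP : Unique P) (|P|≡1+Δ : length P ≡ suc Δ) where
      private
        Σ𝟙ℚ≡toℚΣ𝟙 : (f : ℕ → Bool) → Σℚ P (λ a → 𝟙ℚ (f a)) ≡ toℚ (Σℕ P (λ a → 𝟙 (f a)))
        Σ𝟙ℚ≡toℚΣ𝟙 f = sym (toℚ-Σℕ P (λ a → 𝟙 (f a)))

        p₀ = choiceProb Δ 0 * 1ℚ

      total : Σℚ (0 ∷ P) (λ a → choiceProb Δ a * 1ℚ) ≡ 1ℚ
      total = begin
        p₀ + Σℚ P (λ a → choiceProb Δ a * 1ℚ) ≡⟨ cong (_+_ p₀) (Σ-choiceProb P P≢0 (λ _ → 1ℚ)) ⟩
        p₀ + q Δ * Σℚ P (λ _ → 1ℚ)             ≡⟨ cong (λ r → p₀ + q Δ * r) (trans (Σ𝟙ℚ≡toℚΣ𝟙 (λ _ → true)) (cong toℚ (trans (Σℕ-one P) |P|≡1+Δ))) ⟩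
        p₀ + q Δ * toℚ (suc Δ)                 ≡⟨ cong (_+_ p₀) (q*[1+Δ]≡1/100 Δ) ⟩
        1ℚ ∎
        where open ≡-Reasoning

      Δ≤avoiders : ∀ c → Δ ℕ.≤ Σℕ P (λ a → 𝟙 (not (c ≡ᵇ a)))
      Δ≤avoiders c = ℕ.+-cancelʳ-≤ 1 Δ avoiders (begin
        Δ ℕ.+ 1                        ≡⟨ ℕ.+-comm Δ 1 ⟩
        suc Δ                          ≡⟨ sym (trans (Σ𝟙-not+Σ𝟙≡length (c ≡ᵇ_) P) |P|≡1+Δ) ⟩
        avoiders ℕ.+ occurrences c P   ≤⟨ ℕ.+-monoʳ-≤ avoiders (occurrences-unique c P uniqueP) ⟩
        avoiders ℕ.+ 1                 ∎)
        where
        open ℕ.≤-Reasoning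
        avoiders = Σℕ P (λ a → 𝟙 (not (c ≡ᵇ a)))

      picks : (c : ℕ) → c ≢ 0 → q Δ * 𝟙ℚ (any (c ≡ᵇ_) P) ≤ Σℚ (0 ∷ P) (λ a → choiceProb Δ a * 𝟙ℚ (c ≡ᵇ a))
      picks zero    c≢0 = ⊥-elim (c≢0 refl)
      picks (suc c) _   = begin
        q Δ * 𝟙ℚ (any (suc c ≡ᵇ_) P)          ≤⟨ *-monoˡ-≤-0≤ (0≤q Δ) (≤-trans (toℚ-mono-≤ (𝟙-any≤Σ (suc c ≡ᵇ_) P)) (≤-reflexive (sym (Σ𝟙ℚ≡toℚΣ𝟙 _)))) ⟩
        q Δ * Σℚ P (λ a → 𝟙ℚ (suc c ≡ᵇ a))    ≡⟨ sym (Σ-choiceProb P P≢0 _) ⟩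
        Σℚ P (λ a → choiceProb Δ a * 𝟙ℚ (suc c ≡ᵇ a))      ≡⟨ sym (+-identityˡ _) ⟩
        0ℚ + Σℚ P (λ a → choiceProb Δ a * 𝟙ℚ (suc c ≡ᵇ a)) ≡⟨ cong (_+ Σℚ P (λ a → choiceProb Δ a * 𝟙ℚ (suc c ≡ᵇ a))) (sym (*-zeroʳ (choiceProb Δ 0))) ⟩
        Σℚ (0 ∷ P) (λ a → choiceProb Δ a * 𝟙ℚ (suc c ≡ᵇ a)) ∎
        where open ≤-Reasoning

      avoids : (c : ℕ) → c ≢ 0 → 1ℚ - q Δ ≤ Σℚ (0 ∷ P) (λ a → choiceProb Δ a * 𝟙ℚ (not (c ≡ᵇ a)))
      avoids zero    c≢0 = ⊥-elim (c≢0 refl)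
      avoids (suc c) _   = begin
        1ℚ - q Δ                                       ≡⟨ 1-q≡p₀+qΔ ⟩
        p₀ + q Δ * toℚ Δ                               ≤⟨ +-monoʳ-≤ p₀ (*-monoˡ-≤-0≤ (0≤q Δ) (≤-trans (toℚ-mono-≤ (Δ≤avoiders (suc c))) (≤-reflexive (sym (Σ𝟙ℚ≡toℚΣ𝟙 _))))) ⟩
        p₀ + q Δ * Σℚ P (λ a → 𝟙ℚ (not (suc c ≡ᵇ a))) ≡⟨ cong (_+_ p₀) (sym (Σ-choiceProb P P≢0 _)) ⟩
        Σℚ (0 ∷ P) (λ a → choiceProb Δ a * 𝟙ℚ (not (suc c ≡ᵇ a))) ∎
        where
        open ≤-Reasoning
        1-q≡p₀+qΔ : 1ℚ - q Δ ≡ p₀ + q Δ * toℚ Δ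
        1-q≡p₀+qΔ = begin-equality
          (p₀ + + 1 / 100) - q Δ                ≡⟨ cong (λ r → (p₀ + r) - q Δ) (sym (q*[1+Δ]≡1/100 Δ)) ⟩
          (p₀ + q Δ * toℚ (suc Δ)) - q Δ        ≡⟨ cong (λ r → (p₀ + q Δ * r) - q Δ) (toℚ-+ 1 Δ) ⟩
          (p₀ + q Δ * (1ℚ + toℚ Δ)) - q Δ       ≡⟨ solve 3 (λ a x d → (a :+ x :* (con 1ℚ :+ d)) :- x := a :+ x :* d) refl p₀ (q Δ) (toℚ Δ) ⟩
          p₀ + q Δ * toℚ Δ                      ∎

      fitsᵇ-marginal≥ : ∀ t a c → c ≢ 0 →
        pickFactor t (q Δ * 𝟙ℚ (any (c ≡ᵇ_) P)) * (1ℚ - riskTerm t a) ≤ Σℚ (0 ∷ P) (λ x → choiceProb Δ x * 𝟙ℚ (fitsᵇ t a c x))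
      fitsᵇ-marginal≥ true  a     c c≢0 = ≤-trans (≤-reflexive (*-identityʳ (q Δ * 𝟙ℚ (any (c ≡ᵇ_) P)))) (picks c c≢0)
      fitsᵇ-marginal≥ false true  c c≢0 = ≤-trans (≤-reflexive (*-identityˡ (1ℚ - q Δ))) (avoids c c≢0)
      fitsᵇ-marginal≥ false false c _   = ≤-reflexive (sym total)

module Witnesses {n : ℕ} (G : Graph n) (Pal : Fin n → List ℕ) (v : Fin n) where
  open import Data.Bool using (Bool; true; false; not; _∧_; _∨_; if_then_else_)
  open import Data.Bool.ListAction using (all)
  open import Data.Bool.Properties using (T-≡; ∨-comm)
  open import Data.Nat using (_≡ᵇ_)
  import Data.Nat.Properties as ℕ
  open import Data.List using (map; allFin; concatMap)
  open import Data.Product using (_,_; proj₁; proj₂)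
  open import Data.Empty using (⊥-elim)
  open import Function using (_∘_; Equivalence)
  open import Relation.Binary.PropositionalEquality
  open Sums
  open Counting
  open ChoiceProbabilities using (fitsᵇ)

  fitsAt : (target avoid : Fin n → Bool) (c : ℕ) → Fin n → ℕ → Bool
  fitsAt target avoid c y = fitsᵇ (target y) (avoid y) c

  fits : (target avoid : Fin n → Bool) (c : ℕ) → (Fin n → ℕ) → Bool
  fits target avoid c A = all (λ y → fitsAt target avoid c y (A y)) (allFin n)

  fitsAt-target : ∀ {target avoid c y a} → target y ≡ true → fitsAt target avoid c y a ≡ true → a ≡ c
  fitsAt-target {target} {y = y} ty fits rewrite ty = sym (≡ᵇ⇒≡ fits)

  fitsAt-avoid : ∀ {target avoid c y a} → target y ≡ false → avoid y ≡ true → fitsAt target avoid c y a ≡ true → a ≢ c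
  fitsAt-avoid {target} {avoid} {c} {y} {a} ty ay fits rewrite ty | ay with c ≡ᵇ a in eq
  ... | false = λ a≡c → ≡ᵇ-false⇒≢ eq (sym a≡c)

  target₁ : Fin n → Fin n → Bool
  target₁ x y = y =ᶠ x

  avoid₁ : Fin n → Fin n → Bool
  avoid₁ x y = adj G v y ∨ adj G x y

  guard₁ : ℕ → Fin n → Bool
  guard₁ c x = adj G v x ∧ (not (c ≡ᵇ 0) ∧ not (inPal G Pal c v))

  witness₁ : ℕ → Fin n → (Fin n → ℕ) → ℕ
  witness₁ c x A = 𝟙 (guard₁ c x ∧ fits (target₁ x) (avoid₁ x) c A)

  target₂ : Fin n → Fin n → Fin n → Bool
  target₂ u w y = (y =ᶠ u) ∨ (y =ᶠ w)

  avoid₂ : Fin n → Fin n → Fin n → Bool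
  avoid₂ u w y = adj G v y ∨ (adj G u y ∨ adj G w y)

  guard₂ : ℕ → Fin n → Fin n → Bool
  guard₂ c u w = adj G v u ∧ (adj G v w ∧ (not (u =ᶠ w) ∧ (not (adj G u w) ∧ (not (c ≡ᵇ 0) ∧ inPal G Pal c v))))

  witness₂ : ℕ → Fin n → Fin n → (Fin n → ℕ) → ℕ
  witness₂ c u w A = 𝟙 (guard₂ c u w ∧ fits (target₂ u w) (avoid₂ u w) c A)

  pairs : List (Fin n × Fin n)
  pairs = concatMap (λ u → map (u ,_) (allFin n)) (allFin n)

  Σℕ-pairs : (h : Fin n → Fin n → ℕ) → Σℕ pairs (λ p → h (proj₁ p) (proj₂ p)) ≡ Σℕ (allFin n) (λ u → Σℕ (allFin n) (h u))
  Σℕ-pairs h = trans (Σℕ-concatMap (allFin n) _ _) (Σℕ-cong (allFin n) (λ u → Σℕ-map (allFin n) (u ,_) _))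

  adj⇒≢ : ∀ {x w} → adj G x w ≡ true → w ≢ x
  adj⇒≢ {x} e refl = true≢false e (irrefl G x)

  χ-uncontested : (A : Fin n → ℕ) (x : Fin n) (c : ℕ) → A x ≡ c → c ≢ 0 →
    (∀ w → adj G x w ≡ true → A w ≢ c) → χ G Pal A x ≡ c
  χ-uncontested A x c Ax≡c c≢0 uncontested
    rewrite ≢⇒≡ᵇ-false {A x} {0} (λ e → c≢0 (trans (sym Ax≡c) e))
          | all-filterᵇ (adj G x) (λ w → not (A w ≡ᵇ A x)) (allFin n)
              (λ w xw → cong not (≢⇒≡ᵇ-false (λ e → uncontested w xw (trans e Ax≡c)))) = Ax≡c

  targets≤colorCount : (chosen : Fin n → Bool) (A : Fin n → ℕ) (c : ℕ) →
    (∀ y → chosen y ≡ true → adj G v y ≡ true) → (∀ y → chosen y ≡ true → χ G Pal A y ≡ c) →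
    Σℕ (allFin n) (𝟙 ∘ chosen) ℕ.≤ colorCount G Pal A v c
  targets≤colorCount chosen A c chosen⇒adj chosen⇒χ = subst (_ ℕ.≤_) (sym colorCount≡Σ) (Σℕ-mono (allFin n) pointwise)
    where
    counted : Fin n → ℕ
    counted y = if adj G v y then 𝟙 (χ G Pal A y ≡ᵇ c) else 0
    colorCount≡Σ : colorCount G Pal A v c ≡ Σℕ (allFin n) counted
    colorCount≡Σ = trans (length-filterᵇ≡Σ (λ w → χ G Pal A w ≡ᵇ c) (nbrs G v)) (Σℕ-filterᵇ (adj G v) (allFin n) _)
    pointwise : ∀ y → 𝟙 (chosen y) ℕ.≤ counted y
    pointwise y with chosen y in chosen-y
    ... | false = ℕ.z≤n
    ... | true rewrite chosen⇒adj y chosen-y | chosen⇒χ y chosen-y | ≡ᵇ-refl c = ℕ.≤-refl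

  isGood-intro : ∀ {A c} → c ≢ 0 → suc (iverson G Pal (inPal G Pal c v)) ℕ.≤ colorCount G Pal A v c → isGood G Pal A v c ≡ true
  isGood-intro c≢0 enough rewrite ≢⇒≡ᵇ-false c≢0 = Equivalence.to T-≡ (ℕ.≤⇒≤ᵇ enough)

  count-target₂ : ∀ {u w} → (u =ᶠ w) ≡ false → Σℕ (allFin n) (𝟙 ∘ target₂ u w) ≡ 2
  count-target₂ {u} {w} u≠w = trans (Σℕ-cong (allFin n) split) (trans (Σℕ-+ (allFin n) _ _) (cong₂ ℕ._+_ (count-=ᶠ u) (count-=ᶠ w)))
    where
    split : ∀ y → 𝟙 (target₂ u w y) ≡ 𝟙 (y =ᶠ u) ℕ.+ 𝟙 (y =ᶠ w)
    split y with y =ᶠ u in yu | y =ᶠ w in yw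
    ... | true  | true  = ⊥-elim (=ᶠ-false⇒≢ {x = u} {y = w} u≠w (trans (sym (=ᶠ⇒≡ {x = y} yu)) (=ᶠ⇒≡ {x = y} yw)))
    ... | true  | false = refl
    ... | false | _     = refl

  module SingleWitness (c : ℕ) (x : Fin n) (A : Fin n → ℕ) (e : witness₁ c x A ≡ 1) where
    private
      guard×fits = ∧-split {guard₁ c x} (𝟙≡1⇒true e)
      adj×colour = ∧-split {adj G v x} (proj₁ guard×fits)
      c≢0×c∉Pal = ∧-split {not (c ≡ᵇ 0)} (proj₂ adj×colour)

    adj-v : adj G v x ≡ true
    adj-v = proj₁ adj×colour

    c≢0 : c ≢ 0
    c≢0 = ≡ᵇ-false⇒≢ (not-true (proj₁ c≢0×c∉Pal))

    c∉Pal-v : inPal G Pal c v ≡ false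
    c∉Pal-v = not-true (proj₂ c≢0×c∉Pal)

    fitsAll : ∀ y → fitsAt (target₁ x) (avoid₁ x) c y (A y) ≡ true
    fitsAll = all-allFin _ (proj₂ guard×fits)

    chooses : A x ≡ c
    chooses = fitsAt-target {target₁ x} {avoid₁ x} {c} {x} (=ᶠ-refl x) (fitsAll x)

    χ≡c : χ G Pal A x ≡ c
    χ≡c = χ-uncontested A x c chooses c≢0 λ w xw →
      fitsAt-avoid {target₁ x} {avoid₁ x} {c} {w} (≢⇒=ᶠ-false (adj⇒≢ xw)) (trans (cong (adj G v w ∨_) xw) (∨-zeroʳ _)) (fitsAll w)

    good : isGood G Pal A v c ≡ true
    good = isGood-intro {A} {c} c≢0 (subst (λ b → suc (iverson G Pal b) ℕ.≤ colorCount G Pal A v c) (sym c∉Pal-v)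
      (subst (ℕ._≤ _) (count-=ᶠ x) (targets≤colorCount (target₁ x) A c (at-x adj-v) (at-x χ≡c))))
      where
      at-x : {P : Fin n → Set} → P x → ∀ y → (y =ᶠ x) ≡ true → P y
      at-x {P} Px y y=x = subst P (sym (=ᶠ⇒≡ y=x)) Px

  witness₁-unique : ∀ {c x x'} {A : Fin n → ℕ} → witness₁ c x A ≡ 1 → witness₁ c x' A ≡ 1 → x' ≡ x
  witness₁-unique {c} {x} {x'} {A} e e' with x' =ᶠ x in x'=x
  ... | true  = =ᶠ⇒≡ x'=x
  ... | false = ⊥-elim (fitsAt-avoid {target₁ x} {avoid₁ x} {c} {x'} x'=x (∨-trueˡ _ (SingleWitness.adj-v c x' A e'))
                         (SingleWitness.fitsAll c x A e x') (SingleWitness.chooses c x' A e'))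

  Σwitness₁≤𝟙good : ∀ c A → Σℕ (allFin n) (λ x → witness₁ c x A) ℕ.≤ 1 ℕ.* 𝟙 (isGood G Pal A v c)
  Σwitness₁≤𝟙good c A = Σ𝟙≤m*𝟙 (allFin n) (λ x → witness₁ c x A) 1 _ (λ _ → 𝟙≤1 _) (λ x → SingleWitness.good c x A)
    λ i e → subst (_ ℕ.≤_) (count-=ᶠ i) (Σℕ-mono (allFin n) (only-i i e))
    where
    only-i : ∀ i → witness₁ c i A ≡ 1 → ∀ x → witness₁ c x A ℕ.≤ 𝟙 (x =ᶠ i)
    only-i i e x with guard₁ c x ∧ fits (target₁ x) (avoid₁ x) c A in wx
    ... | false = ℕ.z≤n
    ... | true rewrite witness₁-unique {c} {i} {x} {A} e (cong 𝟙 wx) | =ᶠ-refl i = ℕ.≤-refl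

  module PairWitness (c : ℕ) (u w : Fin n) (A : Fin n → ℕ) (e : witness₂ c u w A ≡ 1) where
    private
      guard×fits = ∧-split {guard₂ c u w} (𝟙≡1⇒true e)
      s₁ = ∧-split {adj G v u} (proj₁ guard×fits)
      s₂ = ∧-split {adj G v w} (proj₂ s₁)
      s₃ = ∧-split {not (u =ᶠ w)} (proj₂ s₂)
      s₄ = ∧-split {not (adj G u w)} (proj₂ s₃)
      s₅ = ∧-split {not (c ≡ᵇ 0)} (proj₂ s₄)

    adj-vu : adj G v u ≡ true
    adj-vu = proj₁ s₁

    adj-vw : adj G v w ≡ true
    adj-vw = proj₁ s₂

    u≠w : (u =ᶠ w) ≡ false
    u≠w = not-true (proj₁ s₃)

    u≁w : adj G u w ≡ false
    u≁w = not-true (proj₁ s₄)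

    c≢0 : c ≢ 0
    c≢0 = ≡ᵇ-false⇒≢ (not-true (proj₁ s₅))

    c∈Pal-v : inPal G Pal c v ≡ true
    c∈Pal-v = proj₂ s₅

    fitsAll : ∀ y → fitsAt (target₂ u w) (avoid₂ u w) c y (A y) ≡ true
    fitsAll = all-allFin _ (proj₂ guard×fits)

    chooses-u : A u ≡ c
    chooses-u = fitsAt-target {target₂ u w} {avoid₂ u w} {c} {u} (∨-trueˡ (u =ᶠ w) (=ᶠ-refl u)) (fitsAll u)

    chooses-w : A w ≡ c
    chooses-w = fitsAt-target {target₂ u w} {avoid₂ u w} {c} {w} (trans (cong ((w =ᶠ u) ∨_) (=ᶠ-refl w)) (∨-zeroʳ _)) (fitsAll w)

    only-targets : ∀ z → adj G v z ≡ true → A z ≡ c → target₂ u w z ≡ true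
    only-targets z vz Az≡c with target₂ u w z in tz
    ... | true  = refl
    ... | false = ⊥-elim (fitsAt-avoid {target₂ u w} {avoid₂ u w} {c} {z} tz (∨-trueˡ _ vz) (fitsAll z) Az≡c)

    private
      not-target : ∀ {x y z} → adj G x z ≡ true → adj G x y ≡ false → ((z =ᶠ x) ∨ (z =ᶠ y)) ≡ false
      not-target {x} {y} {z} xz x≁y rewrite ≢⇒=ᶠ-false (adj⇒≢ xz) =
        ≢⇒=ᶠ-false (λ z≡y → true≢false (trans (cong (adj G x) (sym z≡y)) xz) x≁y)

    χu≡c : χ G Pal A u ≡ c
    χu≡c = χ-uncontested A u c chooses-u c≢0 λ z uz →
      fitsAt-avoid {target₂ u w} {avoid₂ u w} {c} {z} (not-target uz u≁w)
        (trans (cong (λ b → adj G v z ∨ (b ∨ adj G w z)) uz) (∨-zeroʳ _)) (fitsAll z)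

    χw≡c : χ G Pal A w ≡ c
    χw≡c = χ-uncontested A w c chooses-w c≢0 λ z wz →
      fitsAt-avoid {target₂ u w} {avoid₂ u w} {c} {z} (trans (∨-comm (z =ᶠ u) (z =ᶠ w)) (not-target wz (trans (symm G w u) u≁w)))
        (trans (cong (λ b → adj G v z ∨ (adj G u z ∨ b)) wz) (trans (cong (adj G v z ∨_) (∨-zeroʳ _)) (∨-zeroʳ _))) (fitsAll z)

    good : isGood G Pal A v c ≡ true
    good = isGood-intro {A} {c} c≢0 (subst (λ b → suc (iverson G Pal b) ℕ.≤ colorCount G Pal A v c) (sym c∈Pal-v)
      (subst (ℕ._≤ _) (count-target₂ u≠w) (targets≤colorCount (target₂ u w) A c (at-targets adj-vu adj-vw) (at-targets χu≡c χw≡c))))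
      where
      at-targets : {P : Fin n → Set} → P u → P w → ∀ y → target₂ u w y ≡ true → P y
      at-targets {P} Pu Pw y t with y =ᶠ u in y=u | y =ᶠ w in y=w
      ... | true  | _    = subst P (sym (=ᶠ⇒≡ y=u)) Pu
      ... | false | true = subst P (sym (=ᶠ⇒≡ y=w)) Pw

  Σwitness₂≤4*𝟙good : ∀ c A → Σℕ pairs (λ p → witness₂ c (proj₁ p) (proj₂ p) A) ℕ.≤ 4 ℕ.* 𝟙 (isGood G Pal A v c)
  Σwitness₂≤4*𝟙good c A = Σ𝟙≤m*𝟙 pairs _ 4 _ (λ _ → 𝟙≤1 _) (λ p → PairWitness.good c (proj₁ p) (proj₂ p) A) at-most-4
    where
    at-most-4 : ∀ p → witness₂ c (proj₁ p) (proj₂ p) A ≡ 1 → Σℕ pairs (λ p → witness₂ c (proj₁ p) (proj₂ p) A) ℕ.≤ 4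
    at-most-4 (u , w) e = begin
      Σℕ pairs (λ p → witness₂ c (proj₁ p) (proj₂ p) A)      ≡⟨ Σℕ-pairs (λ u' w' → witness₂ c u' w' A) ⟩
      Σℕ (allFin n) (λ u' → Σℕ (allFin n) (λ w' → witness₂ c u' w' A))
        ≤⟨ Σℕ-mono (allFin n) (λ u' → Σℕ-mono (allFin n) (λ w' → both-targets u' w')) ⟩
      Σℕ (allFin n) (λ u' → Σℕ (allFin n) (λ w' → t u' ℕ.* t w')) ≡⟨ Σℕ-cong (allFin n) (λ u' → Σℕ-scaleˡ (allFin n) (t u') t) ⟩
      Σℕ (allFin n) (λ u' → t u' ℕ.* Σℕ (allFin n) t)           ≡⟨ Σℕ-cong (allFin n) (λ u' → ℕ.*-comm (t u') (Σℕ (allFin n) t)) ⟩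
      Σℕ (allFin n) (λ u' → Σℕ (allFin n) t ℕ.* t u')           ≡⟨ Σℕ-scaleˡ (allFin n) (Σℕ (allFin n) t) t ⟩
      Σℕ (allFin n) t ℕ.* Σℕ (allFin n) t                       ≡⟨ cong (λ k → k ℕ.* k) (count-target₂ (PairWitness.u≠w c u w A e)) ⟩
      4 ∎
      where
      open ℕ.≤-Reasoning
      t : Fin n → ℕ
      t = 𝟙 ∘ target₂ u w
      both-targets : ∀ u' w' → witness₂ c u' w' A ℕ.≤ t u' ℕ.* t w'
      both-targets u' w' with guard₂ c u' w' ∧ fits (target₂ u' w') (avoid₂ u' w') c A in e'
      ... | false = ℕ.z≤n
      ... | true
        rewrite PairWitness.only-targets c u w A e u' (PairWitness.adj-vu c u' w' A (cong 𝟙 e')) (PairWitness.chooses-u c u' w' A (cong 𝟙 e'))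
              | PairWitness.only-targets c u w A e w' (PairWitness.adj-vw c u' w' A (cong 𝟙 e')) (PairWitness.chooses-w c u' w' A (cong 𝟙 e')) = ℕ.≤-refl

  witnessCount : ℕ → (Fin n → ℕ) → ℕ
  witnessCount c A = Σℕ (allFin n) (λ x → witness₁ c x A) ℕ.+ Σℕ pairs (λ p → witness₂ c (proj₁ p) (proj₂ p) A)

  witnessCount≤5*𝟙good : ∀ c A → witnessCount c A ℕ.≤ 5 ℕ.* 𝟙 (isGood G Pal A v c)
  witnessCount≤5*𝟙good c A = subst (witnessCount c A ℕ.≤_) (sym (ℕ.*-distribʳ-+ (𝟙 (isGood G Pal A v c)) 1 4))
    (ℕ.+-mono-≤ (Σwitness₁≤𝟙good c A) (Σwitness₂≤4*𝟙good c A))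

  colours : List ℕ
  colours = allColors G Pal

  Σwitnesses≤5|J| : ∀ A → Σℕ colours (λ c → witnessCount c A) ℕ.≤ 5 ℕ.* Jsize G Pal A v
  Σwitnesses≤5|J| A = ℕ.≤-trans (Σℕ-mono colours (λ c → witnessCount≤5*𝟙good c A))
    (ℕ.≤-reflexive (trans (Σℕ-scaleˡ colours 5 _) (cong (5 ℕ.*_) (sym (length-filterᵇ≡Σ (isGood G Pal A v) colours)))))

  #singleCandidates : ℕ
  #singleCandidates = Σℕ colours (λ c → Σℕ (allFin n) (λ x → 𝟙 (guard₁ c x ∧ inPal G Pal c x)))

  #pairCandidates : ℕ
  #pairCandidates = Σℕ colours (λ c → Σℕ pairs (λ p → 𝟙 (guard₂ c (proj₁ p) (proj₂ p) ∧ (inPal G Pal c (proj₁ p) ∧ inPal G Pal c (proj₂ p)))))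

module WitnessProbabilities {n : ℕ} (G : Graph n) (Δ : ℕ) (deg≤Δ : ∀ y → deg G y ℕ.≤ Δ) (Pal : Fin n → List ℕ)
    (|Pal|≡1+Δ : ∀ y → length (Pal y) ≡ suc Δ) (Pal-unique : ∀ y → Unique (Pal y)) (Pal≢0 : ∀ y → All (_≢ 0) (Pal y))
    (v : Fin n) where
  open import Data.Bool using (Bool; true; false; not; _∧_; _∨_)
  open import Data.Bool.ListAction using (all)
  open import Data.Nat using (_≡ᵇ_)
  import Data.Nat.Properties as ℕ
  open import Data.Rational using (_+_)
  open import Data.Rational.Properties
  open import Data.Rational.Solver using (module +-*-Solver)
  open +-*-Solver
  open import Data.List using ([]; _∷_; allFin)
  open import Data.Product using (_,_; proj₁; proj₂)
  open import Function using (_∘_)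
  open import Relation.Binary.PropositionalEquality
  open RationalArithmetic
  open Sums
  open Counting
  open Expectation
  open ChoiceProbabilities
  open Witnesses G Pal v

  opts : Fin n → List ℕ
  opts y = 0 ∷ Pal y

  marginal : (target avoid : Fin n → Bool) (c : ℕ) → Fin n → ℚ
  marginal target avoid c y = Σℚ (opts y) (λ a → choiceProb Δ a * 𝟙ℚ (fitsAt target avoid c y a))

  𝟙ℚ-∧ : ∀ a b → 𝟙ℚ (a ∧ b) ≡ 𝟙ℚ a * 𝟙ℚ b
  𝟙ℚ-∧ true  b = sym (*-identityˡ (𝟙ℚ b))
  𝟙ℚ-∧ false b = sym (*-zeroˡ (𝟙ℚ b))

  𝟙ℚ-all : ∀ {A : Set} (f : A → Bool) (L : List A) → 𝟙ℚ (all f L) ≡ Πℚ L (𝟙ℚ ∘ f)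
  𝟙ℚ-all f []      = refl
  𝟙ℚ-all f (x ∷ L) = trans (𝟙ℚ-∧ (f x) _) (cong (𝟙ℚ (f x) *_) (𝟙ℚ-all f L))

  𝔼-guarded-fits : (b : Bool) (target avoid : Fin n → Bool) (c : ℕ) →
    expect Pal Δ (λ A → 𝟙ℚ (b ∧ fits target avoid c A)) ≡ 𝟙ℚ b * Πℚ (allFin n) (marginal target avoid c)
  𝔼-guarded-fits b target avoid c = begin
    expect Pal Δ (λ A → 𝟙ℚ (b ∧ fits target avoid c A))
      ≡⟨ 𝔼-cong (choiceProb Δ) opts (λ A → trans (𝟙ℚ-∧ b _) (cong (𝟙ℚ b *_) (𝟙ℚ-all _ (allFin n)))) ⟩
    expect Pal Δ (λ A → 𝟙ℚ b * Πℚ (allFin n) (λ y → 𝟙ℚ (fitsAt target avoid c y (A y))))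
      ≡⟨ 𝔼-scaleˡ (choiceProb Δ) opts (𝟙ℚ b) _ ⟩
    𝟙ℚ b * expect Pal Δ (λ A → Πℚ (allFin n) (λ y → 𝟙ℚ (fitsAt target avoid c y (A y))))
      ≡⟨ cong (𝟙ℚ b *_) (𝔼-Πℚ n (choiceProb Δ) opts (λ y a → 𝟙ℚ (fitsAt target avoid c y a))) ⟩
    𝟙ℚ b * Πℚ (allFin n) (marginal target avoid c) ∎
    where open ≡-Reasoning

  pickProb : ℕ → Fin n → ℚ
  pickProb c y = q Δ * 𝟙ℚ (inPal G Pal c y)

  0≤pickProb : ∀ c y → 0ℚ ≤ pickProb c y
  0≤pickProb c y = 0≤* (0≤q Δ) (0≤𝟙ℚ (inPal G Pal c y))

  pickBound : (target : Fin n → Bool) (c : ℕ) → Fin n → ℚ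
  pickBound target c y = pickFactor (target y) (pickProb c y)

  avoidRisk : (target avoid : Fin n → Bool) → Fin n → ℚ
  avoidRisk target avoid y = riskTerm Δ (target y) (avoid y)

  Πmarginal≥ : (target avoid : Fin n → Bool) (c : ℕ) → c ≢ 0 →
    Πℚ (allFin n) (pickBound target c) * (1ℚ - Σℚ (allFin n) (avoidRisk target avoid)) ≤ Πℚ (allFin n) (marginal target avoid c)
  Πmarginal≥ target avoid c c≢0 =
    Πℚ-≥-1-Σℚ (allFin n) (marginal target avoid c) (pickBound target c) (avoidRisk target avoid)
      (λ y → 0≤Σℚ (opts y) (λ a → 0≤* (0≤choiceProb Δ a) (0≤𝟙ℚ (fitsAt target avoid c y a))))
      (λ y → 0≤pickFactor (target y) (0≤pickProb c y))
      (λ y → 0≤riskTerm Δ (target y) (avoid y))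
      (λ y → riskTerm≤1 Δ (target y) (avoid y))
      (λ y → Marginals.fitsᵇ-marginal≥ Δ (Pal y) (Pal≢0 y) (Pal-unique y) (|Pal|≡1+Δ y) (target y) (avoid y) c c≢0)

  deg≡Σ : ∀ a → deg G a ≡ Σℕ (allFin n) (λ y → 𝟙 (adj G a y))
  deg≡Σ a = length-filterᵇ≡Σ (adj G a) (allFin n)

  -- At most 3Δ vertices must avoid c, each failing with probability at most q ≤ 1/(100 Δ).
  97/100≤1-Σrisk : (target avoid : Fin n → Bool) (a₁ a₂ a₃ : Fin n) →
    (∀ y → 𝟙 (avoid y) ℕ.≤ 𝟙 (adj G a₁ y) ℕ.+ (𝟙 (adj G a₂ y) ℕ.+ 𝟙 (adj G a₃ y))) →
    + 97 / 100 ≤ 1ℚ - Σℚ (allFin n) (avoidRisk target avoid)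
  97/100≤1-Σrisk target avoid a₁ a₂ a₃ avoid⊆N = ≤-trans 97/100≤1-3qΔ (1-antimono Σrisk≤3qΔ)
    where
    open ≤-Reasoning
    qΔ = q Δ * toℚ Δ
    N : Fin n → Fin n → ℕ
    N a y = 𝟙 (adj G a y)
    deg-bound : ∀ a → Σℕ (allFin n) (N a) ℕ.≤ Δ
    deg-bound a = subst (ℕ._≤ Δ) (deg≡Σ a) (deg≤Δ a)
    #avoid≤3Δ : Σℕ (allFin n) (𝟙 ∘ avoid) ℕ.≤ Δ ℕ.+ (Δ ℕ.+ Δ)
    #avoid≤3Δ = ℕ.≤-trans (Σℕ-mono (allFin n) avoid⊆N)
      (subst (ℕ._≤ Δ ℕ.+ (Δ ℕ.+ Δ)) (sym (trans (Σℕ-+ (allFin n) (N a₁) _) (cong (Σℕ (allFin n) (N a₁) ℕ.+_) (Σℕ-+ (allFin n) (N a₂) (N a₃)))))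
        (ℕ.+-mono-≤ (deg-bound a₁) (ℕ.+-mono-≤ (deg-bound a₂) (deg-bound a₃))))
    Σrisk≤3qΔ : Σℚ (allFin n) (avoidRisk target avoid) ≤ qΔ + (qΔ + qΔ)
    Σrisk≤3qΔ = begin
      Σℚ (allFin n) (avoidRisk target avoid)       ≤⟨ Σℚ-mono (allFin n) (λ y → riskTerm≤q𝟙 Δ (target y) (avoid y)) ⟩
      Σℚ (allFin n) (λ y → q Δ * 𝟙ℚ (avoid y))     ≡⟨ Σℚ-scaleˡ (allFin n) (q Δ) _ ⟩
      q Δ * Σℚ (allFin n) (𝟙ℚ ∘ avoid)             ≡⟨ cong (q Δ *_) (sym (toℚ-Σℕ (allFin n) _)) ⟩
      q Δ * toℚ (Σℕ (allFin n) (𝟙 ∘ avoid))        ≤⟨ *-monoˡ-≤-0≤ (0≤q Δ) (toℚ-mono-≤ #avoid≤3Δ) ⟩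
      q Δ * toℚ (Δ ℕ.+ (Δ ℕ.+ Δ))                 ≡⟨ cong (q Δ *_) (trans (toℚ-+ Δ _) (cong (_+_ (toℚ Δ)) (toℚ-+ Δ Δ))) ⟩
      q Δ * (toℚ Δ + (toℚ Δ + toℚ Δ))             ≡⟨ solve 2 (λ a d → a :* (d :+ (d :+ d)) := a :* d :+ (a :* d :+ a :* d)) refl (q Δ) (toℚ Δ) ⟩
      qΔ + (qΔ + qΔ)                              ∎
    97/100≤1-3qΔ : + 97 / 100 ≤ 1ℚ - (qΔ + (qΔ + qΔ))
    97/100≤1-3qΔ = 0≤q-p⇒p≤q (≤-trans (0≤* {+ 3 / 1} (≤ᵇ⇒≤ _) (p≤q⇒0≤q-p (q*Δ≤1/100 Δ)))
      (≤-reflexive (solve 1 (λ x → con (+ 3 / 1) :* (con (+ 1 / 100) :- x) := (con 1ℚ :- (x :+ (x :+ x))) :- con (+ 97 / 100)) refl qΔ)))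

  witness-bound : (b : Bool) (target avoid : Fin n → Bool) (c : ℕ) (h : ℚ) → 0ℚ ≤ h →
    (b ≡ true → c ≢ 0) → (b ≡ true → Πℚ (allFin n) (pickBound target c) ≡ h) →
    (b ≡ true → + 97 / 100 ≤ 1ℚ - Σℚ (allFin n) (avoidRisk target avoid)) →
    𝟙ℚ b * h * (+ 97 / 100) ≤ expect Pal Δ (λ A → 𝟙ℚ (b ∧ fits target avoid c A))
  witness-bound false target avoid c h 0≤h _ _ _ =
    ≤-trans (≤-reflexive (trans (cong (_* (+ 97 / 100)) (*-zeroˡ h)) (*-zeroˡ (+ 97 / 100))))
            (0≤𝔼 (choiceProb Δ) opts (0≤choiceProb Δ) (λ A → 0≤𝟙ℚ (false ∧ fits target avoid c A)))
  witness-bound true target avoid c h 0≤h c≢0 Πpick≡h safe = begin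
    1ℚ * h * (+ 97 / 100)                                                     ≡⟨ cong (_* (+ 97 / 100)) (*-identityˡ h) ⟩
    h * (+ 97 / 100)                                                          ≤⟨ *-monoˡ-≤-0≤ 0≤h (safe refl) ⟩
    h * (1ℚ - Σℚ (allFin n) (avoidRisk target avoid))                         ≡⟨ cong (_* _) (sym (Πpick≡h refl)) ⟩
    Πℚ (allFin n) (pickBound target c) * (1ℚ - Σℚ (allFin n) (avoidRisk target avoid)) ≤⟨ Πmarginal≥ target avoid c (c≢0 refl) ⟩
    Πℚ (allFin n) (marginal target avoid c)                                   ≡⟨ sym (*-identityˡ _) ⟩
    1ℚ * Πℚ (allFin n) (marginal target avoid c)                              ≡⟨ sym (𝔼-guarded-fits true target avoid c) ⟩
    expect Pal Δ (λ A → 𝟙ℚ (true ∧ fits target avoid c A))                   ∎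
    where open ≤-Reasoning

  𝔼witness₁≥ : ∀ c x → 𝟙ℚ (guard₁ c x) * pickProb c x * (+ 97 / 100) ≤ expect Pal Δ (toℚ ∘ witness₁ c x)
  𝔼witness₁≥ c x = witness-bound (guard₁ c x) (target₁ x) (avoid₁ x) c (pickProb c x) (0≤pickProb c x)
    (λ g → ≡ᵇ-false⇒≢ (not-true (proj₁ (∧-split {not (c ≡ᵇ 0)} (proj₂ (∧-split {adj G v x} g))))))
    (λ _ → Πℚ-single x (pickProb c))
    (λ _ → 97/100≤1-Σrisk (target₁ x) (avoid₁ x) v x x (λ y → 𝟙-∨-≤ (adj G v y) (adj G x y)))
    where
    𝟙-∨-≤ : ∀ a b → 𝟙 (a ∨ b) ℕ.≤ 𝟙 a ℕ.+ (𝟙 b ℕ.+ 𝟙 b)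
    𝟙-∨-≤ true  b = ℕ.s≤s ℕ.z≤n
    𝟙-∨-≤ false b = ℕ.m≤m+n (𝟙 b) (𝟙 b)

  𝔼witness₂≥ : ∀ c u w → 𝟙ℚ (guard₂ c u w) * (pickProb c u * pickProb c w) * (+ 97 / 100) ≤ expect Pal Δ (toℚ ∘ witness₂ c u w)
  𝔼witness₂≥ c u w = witness-bound (guard₂ c u w) (target₂ u w) (avoid₂ u w) c _ (0≤* (0≤pickProb c u) (0≤pickProb c w))
    c≢0 (Πpick≡ ∘ u≠w)
    (λ _ → 97/100≤1-Σrisk (target₂ u w) (avoid₂ u w) v u w (λ y → 𝟙-∨₃-≤ (adj G v y) (adj G u y) (adj G w y)))
    where
    distinct×rest : guard₂ c u w ≡ true → (not (u =ᶠ w) ∧ (not (adj G u w) ∧ (not (c ≡ᵇ 0) ∧ inPal G Pal c v))) ≡ true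
    distinct×rest g = proj₂ (∧-split {adj G v w} (proj₂ (∧-split {adj G v u} g)))
    u≠w : guard₂ c u w ≡ true → (u =ᶠ w) ≡ false
    u≠w g = not-true (proj₁ (∧-split {not (u =ᶠ w)} (distinct×rest g)))
    c≢0 : guard₂ c u w ≡ true → c ≢ 0
    c≢0 g = ≡ᵇ-false⇒≢ (not-true (proj₁ (∧-split {not (c ≡ᵇ 0)}
              (proj₂ (∧-split {not (adj G u w)} (proj₂ (∧-split {not (u =ᶠ w)} (distinct×rest g))))))))
    𝟙-∨₃-≤ : ∀ a b c → 𝟙 (a ∨ (b ∨ c)) ℕ.≤ 𝟙 a ℕ.+ (𝟙 b ℕ.+ 𝟙 c)
    𝟙-∨₃-≤ true  b c = ℕ.s≤s ℕ.z≤n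
    𝟙-∨₃-≤ false b c = 𝟙-∨ b c
    Πpick≡ : (u =ᶠ w) ≡ false → Πℚ (allFin n) (pickBound (target₂ u w) c) ≡ pickProb c u * pickProb c w
    Πpick≡ u≠w = trans (Πℚ-cong (allFin n) (λ y → pickFactor-∨ (y =ᶠ u) (y =ᶠ w) (pickProb c y)
                                                    (λ y=u → subst (λ z → (z =ᶠ w) ≡ false) (sym (=ᶠ⇒≡ {x = y} y=u)) u≠w)))
      (trans (Πℚ-* (allFin n) (λ y → pickFactor (y =ᶠ u) (pickProb c y)) (λ y → pickFactor (y =ᶠ w) (pickProb c y))) (cong₂ _*_ (Πℚ-single u (pickProb c)) (Πℚ-single w (pickProb c))))

  witnessLowerBound : ℕ → ℚ
  witnessLowerBound c =
    Σℚ (allFin n) (λ x → 𝟙ℚ (guard₁ c x) * pickProb c x * (+ 97 / 100)) +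
    Σℚ pairs (λ p → 𝟙ℚ (guard₂ c (proj₁ p) (proj₂ p)) * (pickProb c (proj₁ p) * pickProb c (proj₂ p)) * (+ 97 / 100))

  witnessLowerBound≤𝔼 : ∀ c → witnessLowerBound c ≤ expect Pal Δ (toℚ ∘ witnessCount c)
  witnessLowerBound≤𝔼 c = begin
    witnessLowerBound c
      ≤⟨ +-mono-≤ (Σℚ-mono (allFin n) (𝔼witness₁≥ c)) (Σℚ-mono pairs (λ p → 𝔼witness₂≥ c (proj₁ p) (proj₂ p))) ⟩
    Σℚ (allFin n) (λ x → expect Pal Δ (toℚ ∘ witness₁ c x)) + Σℚ pairs (λ p → expect Pal Δ (toℚ ∘ witness₂ c (proj₁ p) (proj₂ p)))
      ≡⟨ sym (cong₂ _+_ (𝔼-Σℚ (choiceProb Δ) opts (allFin n) (λ x A → toℚ (witness₁ c x A)))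
                        (𝔼-Σℚ (choiceProb Δ) opts pairs (λ p A → toℚ (witness₂ c (proj₁ p) (proj₂ p) A)))) ⟩
    expect Pal Δ (λ A → Σℚ (allFin n) (λ x → toℚ (witness₁ c x A))) + expect Pal Δ (λ A → Σℚ pairs (λ p → toℚ (witness₂ c (proj₁ p) (proj₂ p) A)))
      ≡⟨ sym (𝔼-+ (choiceProb Δ) opts _ _) ⟩
    expect Pal Δ (λ A → Σℚ (allFin n) (λ x → toℚ (witness₁ c x A)) + Σℚ pairs (λ p → toℚ (witness₂ c (proj₁ p) (proj₂ p) A)))
      ≡⟨ 𝔼-cong (choiceProb Δ) opts (λ A → sym (trans (toℚ-+ (Σℕ (allFin n) (λ x → witness₁ c x A)) _)
                                     (cong₂ _+_ (toℚ-Σℕ (allFin n) (λ x → witness₁ c x A))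
                                                (toℚ-Σℕ pairs (λ p → witness₂ c (proj₁ p) (proj₂ p) A))))) ⟩
    expect Pal Δ (toℚ ∘ witnessCount c) ∎
    where open ≤-Reasoning

  candidateBound : ℚ
  candidateBound = (q Δ * (+ 97 / 100)) * toℚ #singleCandidates + ((q Δ * q Δ) * (+ 97 / 100)) * toℚ #pairCandidates

  ΣwitnessLowerBound≡ : Σℚ colours witnessLowerBound ≡ candidateBound
  ΣwitnessLowerBound≡ = trans (Σℚ-+ colours _ _) (cong₂ _+_
    (trans (Σℚ-cong colours (λ c → trans (Σℚ-cong (allFin n) (single c)) (Σℚ-*toℚ (allFin n) κ₁ _))) (Σℚ-*toℚ colours κ₁ _))
    (trans (Σℚ-cong colours (λ c → trans (Σℚ-cong pairs (λ p → double c (proj₁ p) (proj₂ p))) (Σℚ-*toℚ pairs κ₂ _))) (Σℚ-*toℚ colours κ₂ _)))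
    where
    κ₁ = q Δ * (+ 97 / 100)
    κ₂ = (q Δ * q Δ) * (+ 97 / 100)
    single : ∀ c x → 𝟙ℚ (guard₁ c x) * pickProb c x * (+ 97 / 100) ≡ κ₁ * 𝟙ℚ (guard₁ c x ∧ inPal G Pal c x)
    single c x = trans
      (solve 4 (λ b q p k → b :* (q :* p) :* k := (q :* k) :* (b :* p)) refl (𝟙ℚ (guard₁ c x)) (q Δ) (𝟙ℚ (inPal G Pal c x)) (+ 97 / 100))
      (cong (κ₁ *_) (sym (𝟙ℚ-∧ (guard₁ c x) _)))
    double : ∀ c u w → 𝟙ℚ (guard₂ c u w) * (pickProb c u * pickProb c w) * (+ 97 / 100)
                       ≡ κ₂ * 𝟙ℚ (guard₂ c u w ∧ (inPal G Pal c u ∧ inPal G Pal c w))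
    double c u w = trans
      (solve 5 (λ b q pu pw k → b :* ((q :* pu) :* (q :* pw)) :* k := ((q :* q) :* k) :* (b :* (pu :* pw))) refl
        (𝟙ℚ (guard₂ c u w)) (q Δ) (𝟙ℚ (inPal G Pal c u)) (𝟙ℚ (inPal G Pal c w)) (+ 97 / 100))
      (cong (κ₂ *_) (trans (cong (𝟙ℚ (guard₂ c u w) *_) (sym (𝟙ℚ-∧ (inPal G Pal c u) _))) (sym (𝟙ℚ-∧ (guard₂ c u w) _))))

  |J|≥Σwitnesses/5 : ∀ A → (+ 1 / 5) * Σℚ colours (λ c → toℚ (witnessCount c A)) ≤ toℚ (Jsize G Pal A v)
  |J|≥Σwitnesses/5 A = begin
    (+ 1 / 5) * Σℚ colours (λ c → toℚ (witnessCount c A)) ≡⟨ cong ((+ 1 / 5) *_) (sym (toℚ-Σℕ colours _)) ⟩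
    (+ 1 / 5) * toℚ (Σℕ colours (λ c → witnessCount c A)) ≤⟨ *-monoˡ-≤-0≤ {+ 1 / 5} (≤ᵇ⇒≤ _) (toℚ-mono-≤ (Σwitnesses≤5|J| A)) ⟩
    (+ 1 / 5) * toℚ (5 ℕ.* Jsize G Pal A v)                ≡⟨ cong ((+ 1 / 5) *_) (toℚ-* 5 (Jsize G Pal A v)) ⟩
    (+ 1 / 5) * (toℚ 5 * toℚ (Jsize G Pal A v))            ≡⟨ solve 1 (λ j → con (+ 1 / 5) :* (con (toℚ 5) :* j) := j) refl (toℚ (Jsize G Pal A v)) ⟩
    toℚ (Jsize G Pal A v)                                  ∎
    where open ≤-Reasoning

  expectedJ≥ : (+ 1 / 5) * candidateBound ≤ expectedJ G Pal Δ v
  expectedJ≥ = begin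
    (+ 1 / 5) * candidateBound                                    ≡⟨ cong ((+ 1 / 5) *_) (sym ΣwitnessLowerBound≡) ⟩
    (+ 1 / 5) * Σℚ colours witnessLowerBound                      ≤⟨ *-monoˡ-≤-0≤ {+ 1 / 5} (≤ᵇ⇒≤ _) (Σℚ-mono colours witnessLowerBound≤𝔼) ⟩
    (+ 1 / 5) * Σℚ colours (λ c → expect Pal Δ (toℚ ∘ witnessCount c))       ≡⟨ cong ((+ 1 / 5) *_) (sym (𝔼-Σℚ (choiceProb Δ) opts colours _)) ⟩
    (+ 1 / 5) * expect Pal Δ (λ A → Σℚ colours (λ c → toℚ (witnessCount c A))) ≡⟨ sym (𝔼-scaleˡ (choiceProb Δ) opts (+ 1 / 5) _) ⟩
    expect Pal Δ (λ A → (+ 1 / 5) * Σℚ colours (λ c → toℚ (witnessCount c A))) ≤⟨ 𝔼-mono (choiceProb Δ) opts (0≤choiceProb Δ) |J|≥Σwitnesses/5 ⟩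
    expect Pal Δ (λ A → toℚ (Jsize G Pal A v))                               ∎
    where open ≤-Reasoning

module NeighbourhoodNonEdges {n : ℕ} (G : Graph n) (v : Fin n) where
  open import Data.Bool using (Bool; not; _∧_)
  open import Data.List using (allFin)
  open Sums
  open Counting

  nonEdge : Fin n → Fin n → Bool
  nonEdge u w = adj G v u ∧ (adj G v w ∧ (not (u =ᶠ w) ∧ not (adj G u w)))

  nonEdgesAt : Fin n → ℕ
  nonEdgesAt u = Σℕ (allFin n) (λ w → 𝟙 (nonEdge u w))

  #nonEdges : ℕ
  #nonEdges = Σℕ (allFin n) nonEdgesAt

module PaletteCounting {n : ℕ} (G : Graph n) (Δ : ℕ) (deg≤Δ : ∀ y → deg G y ℕ.≤ Δ) (Pal : Fin n → List ℕ)
    (|Pal|≡1+Δ : ∀ y → length (Pal y) ≡ suc Δ) (Pal-unique : ∀ y → Unique (Pal y)) (Pal≢0 : ∀ y → All (_≢ 0) (Pal y))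
    (v : Fin n) where
  open import Data.Bool using (Bool; true; false; not; _∧_)
  open import Data.Bool.ListAction using (any)
  open import Data.Nat using (_≡ᵇ_)
  import Data.Nat.Properties as ℕ
  open import Data.List using ([]; _∷_; allFin; concatMap)
  open import Data.List.Relation.Unary.All using ([]; _∷_)
  open import Data.List.Relation.Unary.Any using (here; there)
  import Data.List.Relation.Unary.Any as Any
  open import Data.List.Membership.Propositional using (_∈_)
  open import Data.List.Membership.Propositional.Properties using (∈-concatMap⁺; ∈-deduplicate⁺; ∈-allFin)
  open import Data.List.Relation.Unary.Unique.DecPropositional.Properties using (deduplicate-!)
  open import Data.Product using (proj₁; proj₂)
  open import Function using (_∘_)
  open import Relation.Binary.PropositionalEquality
  open import Data.Rational using (_+_)
  open RationalArithmetic
  open Sums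
  open Counting
  open Witnesses G Pal v
  open NeighbourhoodNonEdges G v

  colours-unique : Unique colours
  colours-unique = deduplicate-! ℕ._≟_ (concatMap Pal (allFin n))

  Pal⊆colours : ∀ y {a} → a ∈ Pal y → a ∈ colours
  Pal⊆colours y a∈Pal = ∈-deduplicate⁺ ℕ._≟_ (∈-concatMap⁺ Pal (Any.map (λ { refl → a∈Pal }) (∈-allFin y)))

  #inPal : Fin n → ℕ
  #inPal y = Σℕ colours (λ c → 𝟙 (inPal G Pal c y))

  private
    length≤Σoccurrences : (P : List ℕ) → (∀ {a} → a ∈ P → a ∈ colours) → length P ℕ.≤ Σℕ P (λ a → Σℕ colours (λ c → 𝟙 (c ≡ᵇ a)))
    length≤Σoccurrences []      _    = ℕ.z≤n
    length≤Σoccurrences (x ∷ P) P⊆cs = ℕ.+-mono-≤ (occurrences-∈ (P⊆cs (here refl))) (length≤Σoccurrences P (P⊆cs ∘ there))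

  1+Δ≤#inPal : ∀ y → suc Δ ℕ.≤ #inPal y
  1+Δ≤#inPal y = begin
    suc Δ                                                  ≡⟨ sym (|Pal|≡1+Δ y) ⟩
    length (Pal y)                                         ≤⟨ length≤Σoccurrences (Pal y) (Pal⊆colours y) ⟩
    Σℕ (Pal y) (λ a → Σℕ colours (λ c → 𝟙 (c ≡ᵇ a)))      ≡⟨ Σℕ-swap (Pal y) colours (λ a c → 𝟙 (c ≡ᵇ a)) ⟩
    Σℕ colours (λ c → occurrences c (Pal y))               ≤⟨ Σℕ-mono colours (λ c → Σ≤1⇒Σ≤𝟙-any (c ≡ᵇ_) (Pal y) (occurrences-unique c (Pal y) (Pal-unique y))) ⟩
    #inPal y                                               ∎
    where open ℕ.≤-Reasoning

  #inPal≤1+Δ : ∀ y → #inPal y ℕ.≤ suc Δ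
  #inPal≤1+Δ y = begin
    #inPal y                                               ≤⟨ Σℕ-mono colours (λ c → 𝟙-any≤Σ (c ≡ᵇ_) (Pal y)) ⟩
    Σℕ colours (λ c → occurrences c (Pal y))               ≡⟨ Σℕ-swap colours (Pal y) (λ c a → 𝟙 (c ≡ᵇ a)) ⟩
    Σℕ (Pal y) (λ a → Σℕ colours (λ c → 𝟙 (c ≡ᵇ a)))      ≤⟨ Σℕ-mono (Pal y) at-most-once ⟩
    Σℕ (Pal y) (λ _ → 1)                                   ≡⟨ trans (Σℕ-one (Pal y)) (|Pal|≡1+Δ y) ⟩
    suc Δ                                                  ∎
    where
    open ℕ.≤-Reasoning
    at-most-once : ∀ a → Σℕ colours (λ c → 𝟙 (c ≡ᵇ a)) ℕ.≤ 1
    at-most-once a = subst (ℕ._≤ 1) (Σℕ-cong colours (λ c → cong 𝟙 (≡ᵇ-sym a c))) (occurrences-unique a colours colours-unique)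

  newColour : Fin n → ℕ → Bool
  newColour u c = not (c ≡ᵇ 0) ∧ (not (inPal G Pal c v) ∧ inPal G Pal c u)

  sharedColour : Fin n → Fin n → ℕ → Bool
  sharedColour u w c = not (c ≡ᵇ 0) ∧ (inPal G Pal c v ∧ (inPal G Pal c u ∧ inPal G Pal c w))

  #new : Fin n → ℕ
  #new u = Σℕ colours (𝟙 ∘ newColour u)

  #shared : Fin n → Fin n → ℕ
  #shared u w = Σℕ colours (𝟙 ∘ sharedColour u w)

  private
    inclusion-exclusion : ∀ z pv pu pw → (pu ≡ true → z ≡ false) → (pw ≡ true → z ≡ false) →
      𝟙 pu ℕ.+ 𝟙 pw ℕ.≤ 𝟙 pv ℕ.+ (𝟙 (not z ∧ (pv ∧ (pu ∧ pw))) ℕ.+ (𝟙 (not z ∧ (not pv ∧ pu)) ℕ.+ 𝟙 (not z ∧ (not pv ∧ pw))))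
    inclusion-exclusion true  pv    true  pw    u⇒ _  with () ← u⇒ refl
    inclusion-exclusion true  pv    false true  _  w⇒ with () ← w⇒ refl
    inclusion-exclusion true  pv    false false _  _  = ℕ.z≤n
    inclusion-exclusion false true  true  true  _  _  = ℕ.≤-refl
    inclusion-exclusion false true  true  false _  _  = ℕ.s≤s ℕ.z≤n
    inclusion-exclusion false true  false true  _  _  = ℕ.s≤s ℕ.z≤n
    inclusion-exclusion false true  false false _  _  = ℕ.z≤n
    inclusion-exclusion false false pu    pw    _  _  = ℕ.≤-refl

    inPal⇒≢0 : ∀ c y → inPal G Pal c y ≡ true → (c ≡ᵇ 0) ≡ false
    inPal⇒≢0 c y = ≢⇒≡ᵇ-false ∘ inPal≢0 (Pal y) (Pal≢0 y)
      where
      inPal≢0 : ∀ P → All (_≢ 0) P → any (c ≡ᵇ_) P ≡ true → c ≢ 0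
      inPal≢0 (x ∷ P) (x≢0 ∷ P≢0) e with c ≡ᵇ x in c=x
      ... | true  = λ c≡0 → x≢0 (trans (sym (≡ᵇ⇒≡ c=x)) c≡0)
      ... | false = inPal≢0 P P≢0 e

  -- |Pal u| + |Pal w| ≤ |Pal v| + |Pal v ∩ Pal u ∩ Pal w| + |Pal u ∖ Pal v| + |Pal w ∖ Pal v|
  1+Δ≤#shared+#new+#new : ∀ u w → suc Δ ℕ.≤ #shared u w ℕ.+ (#new u ℕ.+ #new w)
  1+Δ≤#shared+#new+#new u w = ℕ.+-cancelˡ-≤ (suc Δ) _ _ (begin
    suc Δ ℕ.+ suc Δ                                                    ≤⟨ ℕ.+-mono-≤ (1+Δ≤#inPal u) (1+Δ≤#inPal w) ⟩
    #inPal u ℕ.+ #inPal w                                              ≡⟨ sym (Σℕ-+ colours _ _) ⟩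
    Σℕ colours (λ c → 𝟙 (inPal G Pal c u) ℕ.+ 𝟙 (inPal G Pal c w))
      ≤⟨ Σℕ-mono colours (λ c → inclusion-exclusion (c ≡ᵇ 0) (inPal G Pal c v) (inPal G Pal c u) (inPal G Pal c w)
                                                     (inPal⇒≢0 c u) (inPal⇒≢0 c w)) ⟩
    Σℕ colours (λ c → 𝟙 (inPal G Pal c v) ℕ.+ (𝟙 (sharedColour u w c) ℕ.+ (𝟙 (newColour u c) ℕ.+ 𝟙 (newColour w c))))
      ≡⟨ trans (Σℕ-+ colours _ _) (cong (#inPal v ℕ.+_) (trans (Σℕ-+ colours _ _) (cong (#shared u w ℕ.+_) (Σℕ-+ colours _ _)))) ⟩
    #inPal v ℕ.+ (#shared u w ℕ.+ (#new u ℕ.+ #new w))                 ≤⟨ ℕ.+-monoˡ-≤ _ (#inPal≤1+Δ v) ⟩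
    suc Δ ℕ.+ (#shared u w ℕ.+ (#new u ℕ.+ #new w))                    ∎)
    where open ℕ.≤-Reasoning

  nbr : Fin n → ℕ
  nbr x = 𝟙 (adj G v x)

  #singleCandidates≡ : #singleCandidates ≡ Σℕ (allFin n) (λ x → nbr x ℕ.* #new x)
  #singleCandidates≡ = trans (Σℕ-cong colours (λ c → Σℕ-cong (allFin n) (λ x → split (adj G v x) (not (c ≡ᵇ 0)) (not (inPal G Pal c v)) (inPal G Pal c x))))
    (trans (Σℕ-swap colours (allFin n) (λ c x → nbr x ℕ.* 𝟙 (newColour x c)))
      (Σℕ-cong (allFin n) (λ x → Σℕ-scaleˡ colours (nbr x) (𝟙 ∘ newColour x))))
    where
    split : ∀ a z p r → 𝟙 ((a ∧ (z ∧ p)) ∧ r) ≡ 𝟙 a ℕ.* 𝟙 (z ∧ (p ∧ r))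
    split false z     p r = refl
    split true  true  p r = sym (ℕ.+-identityʳ _)
    split true  false p r = refl

  #pairCandidates≡ : #pairCandidates ≡ Σℕ (allFin n) (λ u → Σℕ (allFin n) (λ w → 𝟙 (nonEdge u w) ℕ.* #shared u w))
  #pairCandidates≡ = trans (Σℕ-cong colours (λ c → Σℕ-cong pairs (λ p → split (adj G v (proj₁ p)) (adj G v (proj₂ p))
        (not (proj₁ p =ᶠ proj₂ p)) (not (adj G (proj₁ p) (proj₂ p))) (not (c ≡ᵇ 0)) (inPal G Pal c v)
        (inPal G Pal c (proj₁ p) ∧ inPal G Pal c (proj₂ p)))))
    (trans (Σℕ-swap colours pairs (λ c p → 𝟙 (nonEdge (proj₁ p) (proj₂ p)) ℕ.* 𝟙 (sharedColour (proj₁ p) (proj₂ p) c)))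
      (trans (Σℕ-cong pairs (λ p → Σℕ-scaleˡ colours (𝟙 (nonEdge (proj₁ p) (proj₂ p))) (𝟙 ∘ sharedColour (proj₁ p) (proj₂ p))))
        (Σℕ-pairs (λ u w → 𝟙 (nonEdge u w) ℕ.* #shared u w))))
    where
    split : ∀ a₁ a₂ a₃ a₄ z p r → 𝟙 ((a₁ ∧ (a₂ ∧ (a₃ ∧ (a₄ ∧ (z ∧ p))))) ∧ r) ≡ 𝟙 (a₁ ∧ (a₂ ∧ (a₃ ∧ a₄))) ℕ.* 𝟙 (z ∧ (p ∧ r))
    split false a₂    a₃    a₄    z     p r = refl
    split true  false a₃    a₄    z     p r = refl
    split true  true  false a₄    z     p r = refl
    split true  true  true  false z     p r = refl
    split true  true  true  true  false p r = refl
    split true  true  true  true  true  p r = sym (ℕ.+-identityʳ _)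

  private
    ΣΣ : (Fin n → Fin n → ℕ) → ℕ
    ΣΣ f = Σℕ (allFin n) (λ u → Σℕ (allFin n) (f u))

    ΣΣ-+ : (f g : Fin n → Fin n → ℕ) → ΣΣ (λ u w → f u w ℕ.+ g u w) ≡ ΣΣ f ℕ.+ ΣΣ g
    ΣΣ-+ f g = trans (Σℕ-cong (allFin n) (λ u → Σℕ-+ (allFin n) (f u) (g u))) (Σℕ-+ (allFin n) _ _)

    Σnbr≤Δ : Σℕ (allFin n) nbr ℕ.≤ Δ
    Σnbr≤Δ = subst (ℕ._≤ Δ) (length-filterᵇ≡Σ (adj G v) (allFin n)) (deg≤Δ v)

    nonEdge≤nbr*nbr : ∀ u w → 𝟙 (nonEdge u w) ℕ.≤ nbr u ℕ.* nbr w
    nonEdge≤nbr*nbr u w with adj G v u | adj G v w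
    ... | false | _     = ℕ.z≤n
    ... | true  | false = ℕ.z≤n
    ... | true  | true  = 𝟙≤1 _

  ΣΣnbrPairs≤Δ*Σnbr : (f : Fin n → Fin n → ℕ) (h : Fin n → ℕ) → (∀ u w → f u w ℕ.≤ nbr u ℕ.* nbr w) →
    ΣΣ (λ u w → f u w ℕ.* h u) ℕ.≤ Δ ℕ.* Σℕ (allFin n) (λ u → nbr u ℕ.* h u)
  ΣΣnbrPairs≤Δ*Σnbr f h f≤nbr² = begin
    ΣΣ (λ u w → f u w ℕ.* h u)                                  ≤⟨ Σℕ-mono (allFin n) (λ u → Σℕ-mono (allFin n) (λ w → ℕ.*-monoˡ-≤ (h u) (f≤nbr² u w))) ⟩
    ΣΣ (λ u w → (nbr u ℕ.* nbr w) ℕ.* h u)                      ≡⟨ Σℕ-cong (allFin n) (λ u → trans (Σℕ-cong (allFin n) (λ w → rearrange (nbr u) (nbr w) (h u)))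
                                                                                                  (Σℕ-scaleˡ (allFin n) (nbr u ℕ.* h u) nbr)) ⟩
    Σℕ (allFin n) (λ u → (nbr u ℕ.* h u) ℕ.* Σℕ (allFin n) nbr) ≤⟨ Σℕ-mono (allFin n) (λ u → ℕ.*-monoʳ-≤ (nbr u ℕ.* h u) Σnbr≤Δ) ⟩
    Σℕ (allFin n) (λ u → (nbr u ℕ.* h u) ℕ.* Δ)                 ≡⟨ Σℕ-cong (allFin n) (λ u → ℕ.*-comm (nbr u ℕ.* h u) Δ) ⟩
    Σℕ (allFin n) (λ u → Δ ℕ.* (nbr u ℕ.* h u))                 ≡⟨ Σℕ-scaleˡ (allFin n) Δ _ ⟩
    Δ ℕ.* Σℕ (allFin n) (λ u → nbr u ℕ.* h u)                   ∎
    where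
    open ℕ.≤-Reasoning
    rearrange : ∀ a b c → (a ℕ.* b) ℕ.* c ≡ (a ℕ.* c) ℕ.* b
    rearrange a b c = trans (ℕ.*-assoc a b c) (trans (cong (a ℕ.*_) (ℕ.*-comm b c)) (sym (ℕ.*-assoc a c b)))

  #nonEdges*[1+Δ]≤ : #nonEdges ℕ.* suc Δ ℕ.≤ #pairCandidates ℕ.+ (Δ ℕ.* #singleCandidates ℕ.+ Δ ℕ.* #singleCandidates)
  #nonEdges*[1+Δ]≤ = begin
    #nonEdges ℕ.* suc Δ
      ≡⟨ trans (ℕ.*-comm #nonEdges (suc Δ)) (sym (trans (Σℕ-cong (allFin n) (λ u → Σℕ-scaleˡ (allFin n) (suc Δ) _)) (Σℕ-scaleˡ (allFin n) (suc Δ) _))) ⟩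
    ΣΣ (λ u w → suc Δ ℕ.* ne u w)
      ≤⟨ Σℕ-mono (allFin n) (λ u → Σℕ-mono (allFin n) (λ w →
           subst (ℕ._≤ ne u w ℕ.* (#shared u w ℕ.+ (#new u ℕ.+ #new w))) (ℕ.*-comm (ne u w) (suc Δ))
                 (ℕ.*-monoʳ-≤ (ne u w) (1+Δ≤#shared+#new+#new u w)))) ⟩
    ΣΣ (λ u w → ne u w ℕ.* (#shared u w ℕ.+ (#new u ℕ.+ #new w)))
      ≡⟨ trans (Σℕ-cong (allFin n) (λ u → Σℕ-cong (allFin n) (λ w → distrib (ne u w) (#shared u w) (#new u) (#new w))))
               (trans (ΣΣ-+ _ _) (cong (ΣΣ (λ u w → ne u w ℕ.* #shared u w) ℕ.+_) (ΣΣ-+ _ _))) ⟩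
    ΣΣ (λ u w → ne u w ℕ.* #shared u w) ℕ.+ (ΣΣ (λ u w → ne u w ℕ.* #new u) ℕ.+ ΣΣ (λ u w → ne u w ℕ.* #new w))
      ≤⟨ ℕ.+-mono-≤ (ℕ.≤-reflexive (sym #pairCandidates≡)) (ℕ.+-mono-≤ via-u via-w) ⟩
    #pairCandidates ℕ.+ (Δ ℕ.* #singleCandidates ℕ.+ Δ ℕ.* #singleCandidates) ∎
    where
    open ℕ.≤-Reasoning
    ne : Fin n → Fin n → ℕ
    ne u w = 𝟙 (nonEdge u w)
    distrib : ∀ a x y z → a ℕ.* (x ℕ.+ (y ℕ.+ z)) ≡ a ℕ.* x ℕ.+ (a ℕ.* y ℕ.+ a ℕ.* z)
    distrib a x y z = trans (ℕ.*-distribˡ-+ a x (y ℕ.+ z)) (cong (a ℕ.* x ℕ.+_) (ℕ.*-distribˡ-+ a y z))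
    via-u : ΣΣ (λ u w → ne u w ℕ.* #new u) ℕ.≤ Δ ℕ.* #singleCandidates
    via-u = subst (λ t → ΣΣ (λ u w → ne u w ℕ.* #new u) ℕ.≤ Δ ℕ.* t) (sym #singleCandidates≡) (ΣΣnbrPairs≤Δ*Σnbr ne #new nonEdge≤nbr*nbr)
    via-w : ΣΣ (λ u w → ne u w ℕ.* #new w) ℕ.≤ Δ ℕ.* #singleCandidates
    via-w = subst₂ ℕ._≤_ (sym (Σℕ-swap (allFin n) (allFin n) (λ u w → ne u w ℕ.* #new w))) (cong (Δ ℕ.*_) (sym #singleCandidates≡))
      (ΣΣnbrPairs≤Δ*Σnbr (λ w u → ne u w) #new (λ w u → subst (ne u w ℕ.≤_) (ℕ.*-comm (nbr u) (nbr w)) (nonEdge≤nbr*nbr u w)))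

  #nonEdges*[1+Δ]≤ℚ : toℚ #nonEdges * toℚ (suc Δ) ≤ toℚ #pairCandidates + (toℚ Δ * toℚ #singleCandidates + toℚ Δ * toℚ #singleCandidates)
  #nonEdges*[1+Δ]≤ℚ = subst₂ _≤_ (toℚ-* #nonEdges (suc Δ))
    (trans (toℚ-+ #pairCandidates _) (cong (_+_ (toℚ #pairCandidates))
      (trans (toℚ-+ (Δ ℕ.* #singleCandidates) _) (cong₂ _+_ (toℚ-* Δ #singleCandidates) (toℚ-* Δ #singleCandidates)))))
    (toℚ-mono-≤ #nonEdges*[1+Δ]≤)

module SparseNeighbourhood {n : ℕ} (G : Graph n) (Δ : ℕ) (ε : ℚ) (v : Fin n) where
  open import Data.Bool using (Bool; true; false; not; _∧_; if_then_else_)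
  import Data.Nat.Properties as ℕ
  open import Data.Rational using (_+_)
  open import Data.Rational.Properties
  open import Data.Rational.Solver using (module +-*-Solver)
  open +-*-Solver
  open import Data.List using (allFin)
  open import Data.Product using (proj₁; proj₂)
  open import Function using (_∘_)
  open import Relation.Nullary using (Dec; does; no)
  open import Relation.Binary.PropositionalEquality
  open RationalArithmetic
  open Sums
  open Counting
  open ChoiceProbabilities using (𝟙ℚ; 𝟙ℚ*≤)
  open NeighbourhoodNonEdges G v

  isFriend : Fin n → Bool
  isFriend u = does (friendThreshold G Δ ε ≤? toℚ (common G u v))

  nonFriendNbr : Fin n → Bool
  nonFriendNbr u = adj G v u ∧ not (isFriend u)

  #nonFriendNbrs : ℕ
  #nonFriendNbrs = Σℕ (allFin n) (𝟙 ∘ nonFriendNbr)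

  nonFriendNbr⇒common≤ : ∀ u → nonFriendNbr u ≡ true → toℚ (common G u v) ≤ friendThreshold G Δ ε
  nonFriendNbr⇒common≤ u e = not-friend (friendThreshold G Δ ε ≤? toℚ (common G u v)) (not-true (proj₂ (∧-split {adj G v u} e)))
    where
    not-friend : (d : Dec (friendThreshold G Δ ε ≤ toℚ (common G u v))) → does d ≡ false → toℚ (common G u v) ≤ friendThreshold G Δ ε
    not-friend (no ≰) _ = <⇒≤ (≰⇒> ≰)

  deg≡#nonFriendNbrs+friendCount : deg G v ≡ #nonFriendNbrs ℕ.+ friendCount G Δ ε v
  deg≡#nonFriendNbrs+friendCount = begin
    deg G v                                                            ≡⟨ length-filterᵇ≡Σ (adj G v) (allFin n) ⟩
    Σℕ (allFin n) (λ u → 𝟙 (adj G v u))                                ≡⟨ Σℕ-cong (allFin n) split ⟩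
    Σℕ (allFin n) (λ u → 𝟙 (nonFriendNbr u) ℕ.+ friend u)              ≡⟨ Σℕ-+ (allFin n) _ _ ⟩
    #nonFriendNbrs ℕ.+ Σℕ (allFin n) friend                            ≡⟨ cong (#nonFriendNbrs ℕ.+_) (sym friendCount≡) ⟩
    #nonFriendNbrs ℕ.+ friendCount G Δ ε v                             ∎
    where
    open ≡-Reasoning
    friend : Fin n → ℕ
    friend u = if adj G v u then 𝟙 (isFriend u) else 0
    split : ∀ u → 𝟙 (adj G v u) ≡ 𝟙 (nonFriendNbr u) ℕ.+ friend u
    split u with adj G v u | isFriend u
    ... | true  | true  = refl
    ... | true  | false = refl
    ... | false | _     = refl
    friendCount≡ : friendCount G Δ ε v ≡ Σℕ (allFin n) friend
    friendCount≡ = trans (length-filter≡Σ (λ u → friendThreshold G Δ ε ≤? toℚ (common G u v)) (nbrs G v))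
                         (Σℕ-filterᵇ (adj G v) (allFin n) _)

  -- A neighbour w of v is u itself, a common neighbour of u and v, or forms a non-edge with u.
  deg≤nonEdgesAt+common+1 : ∀ u → adj G v u ≡ true → deg G v ℕ.≤ nonEdgesAt u ℕ.+ (common G u v ℕ.+ 1)
  deg≤nonEdgesAt+common+1 u vu = begin
    deg G v                                     ≡⟨ length-filterᵇ≡Σ (adj G v) (allFin n) ⟩
    Σℕ (allFin n) (λ w → 𝟙 (adj G v w))          ≤⟨ Σℕ-mono (allFin n) classify ⟩
    Σℕ (allFin n) (λ w → 𝟙 (nonEdge u w) ℕ.+ (𝟙 (adj G u w ∧ adj G v w) ℕ.+ 𝟙 (w =ᶠ u)))
      ≡⟨ trans (Σℕ-+ (allFin n) _ _) (cong (nonEdgesAt u ℕ.+_) (Σℕ-+ (allFin n) _ _)) ⟩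
    nonEdgesAt u ℕ.+ (Σℕ (allFin n) (λ w → 𝟙 (adj G u w ∧ adj G v w)) ℕ.+ Σℕ (allFin n) (λ w → 𝟙 (w =ᶠ u)))
      ≡⟨ cong (λ t → nonEdgesAt u ℕ.+ t) (cong₂ ℕ._+_ (sym (length-filterᵇ≡Σ (λ w → adj G u w ∧ adj G v w) (allFin n))) (count-=ᶠ u)) ⟩
    nonEdgesAt u ℕ.+ (common G u v ℕ.+ 1)       ∎
    where
    open ℕ.≤-Reasoning
    classify : ∀ w → 𝟙 (adj G v w) ℕ.≤ 𝟙 (nonEdge u w) ℕ.+ (𝟙 (adj G u w ∧ adj G v w) ℕ.+ 𝟙 (w =ᶠ u))
    classify w with adj G v w in vw
    ... | false = ℕ.z≤n
    ... | true with w =ᶠ u in w=u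
    ...   | true  = ℕ.≤-trans (ℕ.m≤n+m 1 (𝟙 (adj G u w ∧ true))) (ℕ.m≤n+m _ (𝟙 (adj G v u ∧ (not (u =ᶠ w) ∧ not (adj G u w)))))
    ...   | false with adj G u w in uw
    ...     | true  = ℕ.≤-trans (ℕ.s≤s ℕ.z≤n) (ℕ.m≤n+m _ (𝟙 (adj G v u ∧ (not (u =ᶠ w) ∧ not true))))
    ...     | false rewrite vu | ≢⇒=ᶠ-false {x = u} {y = w} (λ u≡w → =ᶠ-false⇒≢ w=u (sym u≡w)) = ℕ.s≤s ℕ.z≤n

  εΔ : ℚ
  εΔ = ε * toℚ Δ

  module _ (sparse : Sparse G Δ ε v) (large-degree : (1ℚ - ε * (+ 1 / 4)) * toℚ Δ ≤ toℚ (deg G v))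
           (εΔ≥3 : toℚ 3 ≤ εΔ) where
    0≤εΔ : 0ℚ ≤ εΔ
    0≤εΔ = ≤-trans (0≤toℚ 3) εΔ≥3

    many-nonFriendNbrs : (+ 3 / 4) * εΔ ≤ toℚ #nonFriendNbrs
    many-nonFriendNbrs = 0≤q-p⇒p≤q (subst (0ℚ ≤_) slack≡ (+-mono-≤ (p≤q⇒0≤q-p degree) (p≤q⇒0≤q-p (<⇒≤ sparse))))
      where
      fc = toℚ (friendCount G Δ ε v)
      degree : (1ℚ - ε * (+ 1 / 4)) * toℚ Δ ≤ toℚ #nonFriendNbrs + fc
      degree = subst (_ ≤_) (trans (cong toℚ deg≡#nonFriendNbrs+friendCount) (toℚ-+ #nonFriendNbrs _)) large-degree
      slack≡ : (toℚ #nonFriendNbrs + fc - (1ℚ - ε * (+ 1 / 4)) * toℚ Δ) + (friendThreshold G Δ ε - fc) ≡ toℚ #nonFriendNbrs - (+ 3 / 4) * εΔ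
      slack≡ = solve 4 (λ a f e D → (a :+ f :- (con 1ℚ :- e :* con (+ 1 / 4)) :* D) :+ ((con 1ℚ :- e) :* D :- f)
                                    := a :- con (+ 3 / 4) :* (e :* D)) refl (toℚ #nonFriendNbrs) fc ε (toℚ Δ)

    -- deg v ≥ (1 - ε/4)Δ while |N(u) ∩ N(v)| < (1 - ε)Δ, and the +1 is absorbed since εΔ ≥ 3.
    many-nonEdgesAt : ∀ u → nonFriendNbr u ≡ true → (+ 5 / 12) * εΔ ≤ toℚ (nonEdgesAt u)
    many-nonEdgesAt u e = 0≤q-p⇒p≤q (subst (0ℚ ≤_) slack≡
        (+-mono-≤ (+-mono-≤ (+-mono-≤ (p≤q⇒0≤q-p deg≤) (p≤q⇒0≤q-p large-degree)) (p≤q⇒0≤q-p (nonFriendNbr⇒common≤ u e)))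
                  (0≤* {+ 1 / 3} (≤ᵇ⇒≤ _) (p≤q⇒0≤q-p εΔ≥3))))
      where
      a = toℚ (nonEdgesAt u)
      c = toℚ (common G u v)
      deg≤ : toℚ (deg G v) ≤ a + (c + toℚ 1)
      deg≤ = subst (toℚ (deg G v) ≤_) (trans (toℚ-+ (nonEdgesAt u) _) (cong (_+_ a) (toℚ-+ (common G u v) 1)))
                   (toℚ-mono-≤ (deg≤nonEdgesAt+common+1 u (proj₁ (∧-split {adj G v u} e))))
      slack≡ : ((((a + (c + toℚ 1)) - toℚ (deg G v)) + (toℚ (deg G v) - (1ℚ - ε * (+ 1 / 4)) * toℚ Δ)) + (friendThreshold G Δ ε - c))
               + (+ 1 / 3) * (εΔ - toℚ 3) ≡ a - (+ 5 / 12) * εΔ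
      slack≡ = solve 5 (λ a c d e D → ((((a :+ (c :+ con (toℚ 1))) :- d) :+ (d :- (con 1ℚ :- e :* con (+ 1 / 4)) :* D)) :+ ((con 1ℚ :- e) :* D :- c))
                                      :+ con (+ 1 / 3) :* (e :* D :- con (toℚ 3)) := a :- con (+ 5 / 12) :* (e :* D))
                       refl a c (toℚ (deg G v)) ε (toℚ Δ)

    many-nonEdges : (+ 5 / 16) * (εΔ * εΔ) ≤ toℚ #nonEdges
    many-nonEdges = begin
      (+ 5 / 16) * (εΔ * εΔ)                         ≡⟨ solve 1 (λ m → con (+ 5 / 16) :* (m :* m) := (con (+ 3 / 4) :* m) :* (con (+ 5 / 12) :* m)) refl εΔ ⟩
      ((+ 3 / 4) * εΔ) * K                           ≤⟨ *-monoʳ-≤-0≤ 0≤K many-nonFriendNbrs ⟩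
      toℚ #nonFriendNbrs * K                         ≡⟨ cong (_* K) (toℚ-Σℕ (allFin n) (𝟙 ∘ nonFriendNbr)) ⟩
      Σℚ (allFin n) (𝟙ℚ ∘ nonFriendNbr) * K          ≡⟨ sym (Σℚ-scaleʳ (allFin n) K _) ⟩
      Σℚ (allFin n) (λ u → 𝟙ℚ (nonFriendNbr u) * K)  ≤⟨ Σℚ-mono (allFin n) each ⟩
      Σℚ (allFin n) (toℚ ∘ nonEdgesAt)               ≡⟨ sym (toℚ-Σℕ (allFin n) nonEdgesAt) ⟩
      toℚ #nonEdges                                  ∎
      where
      open ≤-Reasoning
      K = (+ 5 / 12) * εΔ
      0≤K : 0ℚ ≤ K
      0≤K = 0≤* {+ 5 / 12} (≤ᵇ⇒≤ _) 0≤εΔ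
      each : ∀ u → 𝟙ℚ (nonFriendNbr u) * K ≤ toℚ (nonEdgesAt u)
      each u = 𝟙ℚ*≤ (nonFriendNbr u) (many-nonEdgesAt u) (0≤toℚ (nonEdgesAt u))

module FinalEstimate where
  open import Data.Rational using (_+_)
  open import Data.Rational.Properties
  open import Data.Rational.Solver using (module +-*-Solver)
  open +-*-Solver
  open import Data.Empty using (⊥-elim)
  open import Relation.Binary.PropositionalEquality
  open RationalArithmetic
  open ChoiceProbabilities using (q; 0≤q; q*Δ≤1/100; q*[1+Δ]≡1/100; 0≤1/[1+Δ]; [1+Δ]*1/[1+Δ]≡1)

  εΔ≥3⇒Δ≥1 : ∀ Δ (ε : ℚ) → toℚ 3 ≤ ε * toℚ Δ → 1 ℕ.≤ Δ
  εΔ≥3⇒Δ≥1 zero    ε 3≤0 = ⊥-elim (≤⇒≤ᵇ (≤-trans 3≤0 (≤-reflexive (*-zeroʳ ε))))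
  εΔ≥3⇒Δ≥1 (suc Δ) ε _   = ℕ.s≤s ℕ.z≤n

  1/2≤Δ/[1+Δ] : ∀ Δ → 1 ℕ.≤ Δ → + 1 / 2 ≤ (+ 1 / suc Δ) * toℚ Δ
  1/2≤Δ/[1+Δ] Δ Δ≥1 = 0≤q-p⇒p≤q (subst (0ℚ ≤_) slack≡ (0≤* (0≤* {+ 1 / 2} (≤ᵇ⇒≤ _) (0≤1/[1+Δ] Δ)) (p≤q⇒0≤q-p (toℚ-mono-≤ Δ≥1))))
    where
    r = + 1 / suc Δ
    D = toℚ Δ
    slack≡ : (+ 1 / 2) * r * (D - toℚ 1) ≡ r * D - + 1 / 2
    slack≡ = begin
      (+ 1 / 2) * r * (D - toℚ 1)          ≡⟨ solve 2 (λ r D → con (+ 1 / 2) :* r :* (D :- con (toℚ 1)) := r :* D :- con (+ 1 / 2) :* ((con 1ℚ :+ D) :* r)) refl r D ⟩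
      r * D - (+ 1 / 2) * ((1ℚ + D) * r)   ≡⟨ cong (λ t → r * D - (+ 1 / 2) * (t * r)) (sym (toℚ-+ 1 Δ)) ⟩
      r * D - (+ 1 / 2) * (toℚ (suc Δ) * r) ≡⟨ cong (λ t → r * D - (+ 1 / 2) * t) ([1+Δ]*1/[1+Δ]≡1 Δ) ⟩
      r * D - (+ 1 / 2) * 1ℚ               ≡⟨ cong (r * D -_) (*-identityʳ (+ 1 / 2)) ⟩
      r * D - + 1 / 2                      ∎
      where open ≡-Reasoning

  -- Trading the 2Δ singles for pairs costs a factor 1 - 2Δq ≥ 0 on the single-witness term.
  nonEdges≤candidates : ∀ Δ (s p e : ℚ) → 0ℚ ≤ s → e * toℚ (suc Δ) ≤ p + (toℚ Δ * s + toℚ Δ * s) →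
    (q Δ * (+ 97 / 100) * (+ 1 / 100)) * e ≤ (q Δ * (+ 97 / 100)) * s + ((q Δ * q Δ) * (+ 97 / 100)) * p
  nonEdges≤candidates Δ s p e 0≤s e[1+Δ]≤ = begin
    (Q * k * (+ 1 / 100)) * e                ≡⟨ cong (λ t → Q * k * t * e) (sym (q*[1+Δ]≡1/100 Δ)) ⟩
    (Q * k * (Q * toℚ (suc Δ))) * e          ≡⟨ solve 4 (λ Q k D e → Q :* k :* (Q :* D) :* e := (Q :* Q :* k) :* (e :* D)) refl Q k (toℚ (suc Δ)) e ⟩
    (Q * Q * k) * (e * toℚ (suc Δ))          ≤⟨ *-monoˡ-≤-0≤ Q²k≥0 e[1+Δ]≤ ⟩
    (Q * Q * k) * (p + (D * s + D * s))      ≤⟨ 0≤q-p⇒p≤q (subst (0ℚ ≤_) slack≡ (0≤* (0≤* (0≤* (0≤q Δ) (≤ᵇ⇒≤ _)) 0≤s) (p≤q⇒0≤q-p 2DQ≤1))) ⟩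
    (Q * k) * s + ((Q * Q) * k) * p          ∎
    where
    open ≤-Reasoning
    Q = q Δ
    D = toℚ Δ
    k = + 97 / 100
    Q²k≥0 : 0ℚ ≤ Q * Q * k
    Q²k≥0 = 0≤* (0≤* (0≤q Δ) (0≤q Δ)) (≤ᵇ⇒≤ _)
    2DQ≤1 : (+ 2 / 1) * (D * Q) ≤ 1ℚ
    2DQ≤1 = ≤-trans (*-monoˡ-≤-0≤ {+ 2 / 1} (≤ᵇ⇒≤ _) (≤-trans (≤-reflexive (*-comm D Q)) (q*Δ≤1/100 Δ))) (≤ᵇ⇒≤ _)
    slack≡ : (Q * k * s) * (1ℚ - (+ 2 / 1) * (D * Q)) ≡ ((Q * k) * s + ((Q * Q) * k) * p) - (Q * Q * k) * (p + (D * s + D * s))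
    slack≡ = solve 5 (λ Q k s p D → (Q :* k :* s) :* (con 1ℚ :- con (+ 2 / 1) :* (D :* Q))
                                    := ((Q :* k) :* s :+ ((Q :* Q) :* k) :* p) :- (Q :* Q :* k) :* (p :+ (D :* s :+ D :* s))) refl Q k s p D

  c₀ : ℚ
  c₀ = + 1 / 1000000

  0<c₀ : 0ℚ < c₀
  0<c₀ = positive⁻¹ c₀

  -- q Δ ≥ 1/(200 Δ) once Δ ≥ 1, so one factor Δ of (εΔ)² is absorbed by q.
  c₀ε²Δ≤ : ∀ Δ (ε : ℚ) → 0ℚ ≤ ε → 1 ℕ.≤ Δ →
    c₀ * (ε * ε) * toℚ Δ ≤ (+ 1 / 5) * ((q Δ * (+ 97 / 100) * (+ 1 / 100)) * ((+ 5 / 16) * ((ε * toℚ Δ) * (ε * toℚ Δ))))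
  c₀ε²Δ≤ Δ ε 0≤ε Δ≥1 = begin
    c₀ * (ε * ε) * D                             ≡⟨ solve 3 (λ c e d → c :* (e :* e) :* d := (e :* e :* d) :* c) refl c₀ ε D ⟩
    (ε * ε * D) * c₀                             ≤⟨ *-monoˡ-≤-0≤ ε²D≥0 (≤ᵇ⇒≤ {c₀} {C * (+ 1 / 2)} _) ⟩
    (ε * ε * D) * (C * (+ 1 / 2))                ≤⟨ *-monoˡ-≤-0≤ ε²D≥0 (*-monoˡ-≤-0≤ {C} (≤ᵇ⇒≤ _) (1/2≤Δ/[1+Δ] Δ Δ≥1)) ⟩
    (ε * ε * D) * (C * ((+ 1 / suc Δ) * D))      ≡⟨ solve 3 (λ e d r → (e :* e :* d) :* (con C :* (r :* d))
                                                         := con (+ 1 / 5) :* (((con (+ 1 / 100) :* r) :* con (+ 97 / 100) :* con (+ 1 / 100))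
                                                                               :* (con (+ 5 / 16) :* ((e :* d) :* (e :* d))))) refl ε D (+ 1 / suc Δ) ⟩
    (+ 1 / 5) * ((q Δ * (+ 97 / 100) * (+ 1 / 100)) * ((+ 5 / 16) * ((ε * D) * (ε * D)))) ∎
    where
    open ≤-Reasoning
    D = toℚ Δ
    C = (+ 1 / 5) * (+ 97 / 100) * (+ 1 / 100) * (+ 1 / 100) * (+ 5 / 16)
    ε²D≥0 : 0ℚ ≤ ε * ε * D
    ε²D≥0 = 0≤* (0≤* 0≤ε 0≤ε) (0≤toℚ Δ)

open FinalEstimate

expectedJ≥c₀ε²Δ : (n : ℕ) (G : Graph n) (Δ : ℕ) → IsMaxDegree G Δ →
  (Pal : Fin n → List ℕ) →
  (∀ v → length (Pal v) ≡ suc Δ) → (∀ v → Unique (Pal v)) →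
  (∀ v → All (λ a → a ≢ 0) (Pal v)) →
  (ε : ℚ) → 0ℚ < ε → ε < (+ 1 / 5) →
  toℚ 3 ≤ ε * toℚ Δ →
  (v : Fin n) → Sparse G Δ ε v →
  (1ℚ - ε * (+ 1 / 4)) * toℚ Δ ≤ toℚ (deg G v) →
  c₀ * (ε * ε) * toℚ Δ ≤ expectedJ G Pal Δ v
expectedJ≥c₀ε²Δ n G Δ (deg≤Δ , _) Pal |Pal|≡1+Δ Pal-unique Pal≢0 ε 0<ε _ εΔ≥3 v sparse large-degree = begin
  c₀ * (ε * ε) * toℚ Δ                      ≤⟨ c₀ε²Δ≤ Δ ε (<⇒≤ 0<ε) (εΔ≥3⇒Δ≥1 Δ ε εΔ≥3) ⟩
  (+ 1 / 5) * (κ * ((+ 5 / 16) * (εΔ * εΔ))) ≤⟨ *-monoˡ-≤-0≤ {+ 1 / 5} (≤ᵇ⇒≤ _) (*-monoˡ-≤-0≤ 0≤κ (many-nonEdges sparse large-degree εΔ≥3)) ⟩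
  (+ 1 / 5) * (κ * toℚ #nonEdges)            ≤⟨ *-monoˡ-≤-0≤ {+ 1 / 5} (≤ᵇ⇒≤ _) (nonEdges≤candidates Δ (toℚ #singleCandidates) (toℚ #pairCandidates) (toℚ #nonEdges) (0≤toℚ #singleCandidates) #nonEdges*[1+Δ]≤ℚ) ⟩
  (+ 1 / 5) * candidateBound                 ≤⟨ expectedJ≥ ⟩
  expectedJ G Pal Δ v                        ∎
  where
  open import Data.Rational.Properties using (≤ᵇ⇒≤; <⇒≤; module ≤-Reasoning)
  open ≤-Reasoning
  open RationalArithmetic
  open ChoiceProbabilities using (q; 0≤q)
  open Witnesses G Pal v using (#singleCandidates; #pairCandidates)
  open WitnessProbabilities G Δ deg≤Δ Pal |Pal|≡1+Δ Pal-unique Pal≢0 v using (candidateBound; expectedJ≥)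
  open PaletteCounting G Δ deg≤Δ Pal |Pal|≡1+Δ Pal-unique Pal≢0 v using (#nonEdges*[1+Δ]≤ℚ)
  open NeighbourhoodNonEdges G v using (#nonEdges)
  open SparseNeighbourhood G Δ ε v using (εΔ; many-nonEdges)
  κ : ℚ
  κ = q Δ * (+ 97 / 100) * (+ 1 / 100)
  0≤κ : 0ℚ ≤ κ
  0≤κ = 0≤* (0≤* (0≤q Δ) (≤ᵇ⇒≤ _)) (≤ᵇ⇒≤ _)

mainTheorem12 : Σ ℚ λ c → (0ℚ < c) ×
    ((n : ℕ) (G : Graph n) (Δ : ℕ) → IsMaxDegree G Δ →
     (Pal : Fin n → List ℕ) →
     (∀ v → length (Pal v) ≡ suc Δ) → (∀ v → Unique (Pal v)) →
     (∀ v → All (λ a → a ≢ 0) (Pal v)) →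
     (ε : ℚ) → 0ℚ < ε → ε < (+ 1 / 5) →
     toℚ 3 ≤ ε * toℚ Δ →
     (v : Fin n) → Sparse G Δ ε v →
     (1ℚ - ε * (+ 1 / 4)) * toℚ Δ ≤ toℚ (deg G v) →
     c * (ε * ε) * toℚ Δ ≤ expectedJ G Pal Δ v)
mainTheorem12 = c₀ , 0<c₀ , expectedJ≥c₀ε²Δ
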